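{- Let $K=\mathbb{Q}(\sqrt{D})$ where $D\in\mathbb{Z}_{\ge2}$ is squarefree. (i) For every $m\in\mathbb{Z}_{\ge1}$ there exists $y\in\mathbb{Z}_{\ge0}$ such that $p_K(\lceil y\xi_D\rceil+y\omega_D)\ge m$. (ii) Let $\alpha=(\lceil y\xi_D\rceil+k)+y\omega_D$ with $y,k\in\mathbb{Z}_{\ge0}$, $\alpha\neq0$. If $\alpha/\alpha'\le\varepsilon_+$, then $y<\frac{(k+1)\varepsilon_+-k}{\xi_D+\omega_D}$. (iii) Let $\alpha_1=(\lceil y_1\xi_D\rceil+k_1)+y_1\omega_D$ and $\alpha_2=(\lceil y_2\xi_D\rceil+k_2)+y_2\omega_D$ with $k_1,y_1,k_2,y_2\in\mathbb{Z}_{\ge0}$. If $y_1\le y_2$ and $k_1<k_2$, then $\alpha_1\prec\alpha_2$. (iv) With $\alpha_1,\alpha_2$ as in (iii), if $\alpha_1\preceq\alpha_2$ then $k_1\le k_2$.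
   Context: Let $\omega_D=\sqrt{D}$ and $\xi_D=\sqrt D$ if $D\equiv2,3\pmod4$, and $\omega_D=\frac{1+\sqrt D}{2}$, $\xi_D=\frac{\sqrt D-1}{2}$ if $D\equiv1\pmod4$ (so $\xi_D=-\omega_D'$, where $'$ denotes Galois conjugation). $\mathcal{O}_K$ is the ring of integers of $K$, $\mathcal{O}_K^+$ the set of totally positive elements (those $\gamma$ with $\gamma>0$, $\gamma'>0$). For $\gamma,\delta\in K$, $\gamma\prec\delta$ means $\delta-\gamma$ is totally positive, and $\gamma\preceq\delta$ means $\gamma\prec\delta$ or $\gamma=\delta$. $\varepsilon_+>1$ denotes the smallest totally positive unit of $\mathcal{O}_K$ greater than $1$. A partition of $\alpha\in\mathcal{O}_K^+$ is an expression $\alpha=\alpha_1+\dots+\alpha_n$ with $n\ge1$ and $\alpha_i\in\mathcal{O}_K^+$, order irrelevant; $p_K(\alpha)$ is the number of partitions of $\alpha$, with $p_K(0)=1$. -}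

module Defs where

open import Data.Bool using (Bool; true; false; if_then_else_; _∧_; _∨_; not; T)
open import Data.Nat as ℕ using (ℕ; _%_; _≡ᵇ_; _/_)
open import Data.Nat.Divisibility using (_∣_)
open import Data.Integer as ℤ using (ℤ; +_; _+_; _*_; -_; _-_)
open import Data.Product using (_×_; _,_; proj₁; proj₂; Σ; ∃)
open import Data.Sum using (_⊎_)
open import Data.Fin using (Fin)
open import Data.List using (List; foldr)
open import Data.List.Relation.Unary.All using (All)
open import Data.List.Relation.Binary.Permutation.Propositional using (_↭_)
open import Relation.Nullary using (¬_)
open import Relation.Nullary.Decidable using (⌊_⌋)
open import Relation.Binary.PropositionalEquality using (_≡_; _≢_)

SquareFree : ℕ → Set
SquareFree D = ∀ n → (n ℕ.* n) ∣ D → n ≡ 1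

isOneMod4 : ℕ → Bool
isOneMod4 D = (D % 4) ≡ᵇ 1

-- An element of O_K = Z[ω_D] is written a + b ω_D, encoded as (a , b).
OK : Set
OK = ℤ × ℤ

fromℤ : ℤ → OK
fromℤ n = n , + 0

fromℕ : ℕ → OK
fromℕ n = fromℤ (+ n)

ω : ℕ → OK
ω D = + 0 , + 1

-- ξ_D = √D (D ≡ 2,3 mod 4) or (√D - 1)/2 = ω_D - 1 (D ≡ 1 mod 4)
ξ : ℕ → OK
ξ D = if isOneMod4 D then (- + 1 , + 1) else (+ 0 , + 1)

_⊕_ : OK → OK → OK
(a , b) ⊕ (c , d) = (a + c) , (b + d)

⊝_ : OK → OK
⊝ (a , b) = (- a) , (- b)

_⊖_ : OK → OK → OK
x ⊖ y = x ⊕ (⊝ y)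

-- multiplication, using ω² = D (D ≡ 2,3) or ω² = ω + (D-1)/4 (D ≡ 1)
mul : ℕ → OK → OK → OK
mul D (a , b) (c , d) =
  if isOneMod4 D
  then ((a * c) + (b * d) * (+ ((D ℕ.∸ 1) / 4))) , ((a * d) + (b * c) + (b * d))
  else ((a * c) + (b * d) * (+ D)) , ((a * d) + (b * c))

-- Galois conjugation: ω' = -ω (D ≡ 2,3), ω' = 1 - ω (D ≡ 1)
conj : ℕ → OK → OK
conj D (a , b) = if isOneMod4 D then ((a + b) , (- b)) else (a , (- b))

-- 2·x written as P + Q √D (real embedding, √D > 0)
twice : ℕ → OK → ℤ × ℤ
twice D (a , b) =
  if isOneMod4 D then (((+ 2) * a) + b) , b else ((+ 2) * a) , ((+ 2) * b)

-- p + q √D > 0 in ℝ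
posPQ : ℕ → ℤ → ℤ → Bool
posPQ D p q =
  (⌊ (+ 0) ℤ.≤? p ⌋ ∧ ⌊ (+ 0) ℤ.≤? q ⌋ ∧ not (⌊ p ℤ.≟ + 0 ⌋ ∧ ⌊ q ℤ.≟ + 0 ⌋))
  ∨ (⌊ (+ 0) ℤ.<? p ⌋ ∧ ⌊ q ℤ.<? + 0 ⌋ ∧ ⌊ (q * q) * (+ D) ℤ.<? p * p ⌋)
  ∨ (⌊ p ℤ.<? + 0 ⌋ ∧ ⌊ (+ 0) ℤ.<? q ⌋ ∧ ⌊ p * p ℤ.<? (q * q) * (+ D) ⌋)

-- x > 0 in the (fixed, √D > 0) real embedding of K
Pos : ℕ → OK → Set
Pos D x = T (posPQ D (proj₁ (twice D x)) (proj₂ (twice D x)))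

_<[_]_ : OK → ℕ → OK → Set
x <[ D ] y = Pos D (y ⊖ x)

_≤[_]_ : OK → ℕ → OK → Set
x ≤[ D ] y = ¬ (y <[ D ] x)

TotPos : ℕ → OK → Set
TotPos D x = Pos D x × Pos D (conj D x)

_≺[_]_ : OK → ℕ → OK → Set
γ ≺[ D ] δ = TotPos D (δ ⊖ γ)

_⪯[_]_ : OK → ℕ → OK → Set
γ ⪯[ D ] δ = (γ ≺[ D ] δ) ⊎ (γ ≡ δ)

IsCeil : ℕ → ℤ → OK → Set
IsCeil D c x = (x ≤[ D ] fromℤ c) × (fromℤ c <[ D ] (x ⊕ fromℕ 1))

Unit : ℕ → OK → Set
Unit D x = Σ OK λ u → mul D x u ≡ fromℕ 1

IsEpsPlus : ℕ → OK → Set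
IsEpsPlus D ε = TotPos D ε × Unit D ε × (fromℕ 1 <[ D ] ε)
  × (∀ u → TotPos D u → Unit D u → fromℕ 1 <[ D ] u → ε ≤[ D ] u)

-- α / β ≤ γ  (real comparison), for β ≠ 0
QuotLe : ℕ → OK → OK → OK → Set
QuotLe D α β γ =
  ((fromℕ 0 <[ D ] β) × (α ≤[ D ] mul D γ β))
  ⊎ ((β <[ D ] fromℕ 0) × (mul D γ β ≤[ D ] α))

sumOK : List OK → OK
sumOK = foldr _⊕_ (fromℕ 0)

-- a partition of α: a multiset (list up to permutation) of totally positive
-- elements summing to α (the empty list is the unique partition of 0, so p_K(0)=1)
IsPartition : ℕ → OK → List OK → Set
IsPartition D α l = All (TotPos D) l × (sumOK l ≡ α)

-- p_K(α) ≥ m : there are m pairwise distinct (up to order) partitions of α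
PAtLeast : ℕ → OK → ℕ → Set
PAtLeast D α m = Σ (Fin m → List OK) λ f →
  (∀ i → IsPartition D α (f i)) × (∀ i j → i ≢ j → ¬ (f i ↭ f j))

-- α = (c + k) + y ω with c = ⌈y ξ_D⌉
mkα : ℤ → ℕ → ℕ → OK
mkα c k y = (c + + k) , + y

module Submission where

-- Positivity in K ⊂ ℝ is read off 2 (a + b ω) = (2a + t b) + s b √D: the positive cone of ℤ[√D]
-- is closed under sums and products and, √D being irrational, trichotomous. With g = c − y ξ,
-- c = ⌈ y ξ ⌉ says 0 ≤ g < 1, the conjugate of α = (c + k) + y ω is g + k, and α − α′ = y (ξ + ω) ≥ 0.
-- Parts (iii) and (iv) compare integer parts of conjugates, and (ii) is the identity
-- (k + 1) ε − k − y (ξ + ω) = (ε α′ − α) + ε (1 − g) + g. For (i), the defects ⌈ y ξ ⌉ − y ξ exceed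
-- any finite set of them: if none of those of 1 + z, 1 + 2z, … exceeds that of z, every step lowers
-- the defect by 1 − (⌈ z ξ ⌉ − z ξ) > 0, which by the archimedean property eventually makes it
-- negative. A y > 2(m − 1) whose defect beats those of 1, …, 2(m − 1) then gives m distinct
-- partitions: α itself and β_j + (α − β_j) with β_j = ⌈ j ξ ⌉ + j ω, 1 ≤ j < m.

open import Defs
open import Data.Nat as ℕ using (ℕ; suc)
open import Data.Integer as ℤ using (ℤ; +_; 0ℤ)
open import Data.Product using (_×_; Σ; _,_; proj₁; proj₂)
open import Relation.Binary.PropositionalEquality using (_≡_; _≢_; cong₂)
open import Relation.Nullary using (¬_; Dec; yes; no; contradiction)
import Data.Integer.Properties as ℤP
open import Data.Integer.Tactic.RingSolver using (solve-∀)

infixr 25 _⊙_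
_⊙_ : ℤ → ℤ × ℤ → ℤ × ℤ
n ⊙ (a , b) = (n ℤ.* a , n ℤ.* b)

⊕-comm : ∀ x y → x ⊕ y ≡ y ⊕ x
⊕-comm (a , b) (c , d) = cong₂ _,_ (ℤP.+-comm a c) (ℤP.+-comm b d)

⊕-identityʳ : ∀ x → x ⊕ fromℕ 0 ≡ x
⊕-identityʳ (a , b) = cong₂ _,_ (ℤP.+-identityʳ a) (ℤP.+-identityʳ b)

⊖-self : ∀ x → x ⊖ x ≡ fromℕ 0
⊖-self (a , b) = cong₂ _,_ (ℤP.+-inverseʳ a) (ℤP.+-inverseʳ b)

⊖-trans : ∀ x y z → (x ⊖ y) ⊕ (y ⊖ z) ≡ x ⊖ z
⊖-trans (a , b) (c , d) (e , f) = cong₂ _,_ (telescope a c e) (telescope b d f)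
  where
  telescope : ∀ a c e → a ℤ.- c ℤ.+ (c ℤ.- e) ≡ a ℤ.- e
  telescope = solve-∀

⊝-⊖ : ∀ x y → ⊝ (x ⊖ y) ≡ y ⊖ x
⊝-⊖ (a , b) (c , d) = cong₂ _,_ (negate-difference a c) (negate-difference b d)
  where
  negate-difference : ∀ a c → ℤ.- (a ℤ.- c) ≡ c ℤ.- a
  negate-difference = solve-∀

IrrationalSqrt : ℤ → Set
IrrationalSqrt d = ∀ p q → p ℤ.* p ≡ q ℤ.* q ℤ.* d → q ≡ 0ℤ

module SquareFreeIrrational where
  open import Data.Nat using (zero; NonZero; _*_; _≤_; ≢-nonZero)
  open import Data.Nat.Properties using (*-cancelʳ-≡; *-identityˡ; <⇒≢)
  open import Data.Nat.Divisibility using (divides; ∣-refl; ∣-reflexive)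
  open import Data.Nat.GCD using (gcd; gcd[m,n]∣m; gcd[m,n]∣n; gcd[m,n]≢0)
  open import Data.Nat.Coprimality as Coprimality using (coprime-/gcd; coprime-divisor)
  open import Data.Nat.DivMod using (_/_; m/n*n≡m)
  open import Data.Nat.Tactic.RingSolver using () renaming (solve-∀ to ℕ-solve-∀)
  open import Data.Integer using (∣_∣)
  open import Data.Integer.Properties using (abs-*; ∣i∣≡0⇒i≡0)
  open import Data.Sum using (inj₂)
  open import Data.Empty using (⊥-elim)
  open import Relation.Binary.PropositionalEquality using (_≡_; refl; sym; trans; cong; cong₂)

  -- Dividing a² = b² D by gcd(a, b)² leaves a coprime solution, which forces b = 1 and D = a².
  squareFree⇒a²≡b²D⇒b≡0 : ∀ {D} → 2 ≤ D → SquareFree D → ∀ a b → a * a ≡ b * b * D → b ≡ 0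
  squareFree⇒a²≡b²D⇒b≡0 _ _ a zero _ = refl
  squareFree⇒a²≡b²D⇒b≡0 {D} D≥2 squareFree a b@(suc _) a²≡b²D = ⊥-elim (<⇒≢ D≥2 (sym D≡1))
    where
    g : ℕ
    g = gcd a b
    instance
      g≢0 : NonZero g
      g≢0 = ≢-nonZero (gcd[m,n]≢0 a b (inj₂ λ ()))
    a′ b′ : ℕ
    a′ = a / g
    b′ = b / g
    reduced : a′ * a′ ≡ b′ * b′ * D
    reduced = *-cancelʳ-≡ _ _ g (*-cancelʳ-≡ _ _ g (begin
      a′ * a′ * g * g       ≡⟨ square-* a′ g ⟩
      (a′ * g) * (a′ * g)   ≡⟨ cong₂ _*_ (m/n*n≡m (gcd[m,n]∣m a b)) (m/n*n≡m (gcd[m,n]∣m a b)) ⟩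
      a * a                 ≡⟨ a²≡b²D ⟩
      b * b * D             ≡⟨ cong (λ x → x * x * D) (sym (m/n*n≡m (gcd[m,n]∣n a b))) ⟩
      (b′ * g) * (b′ * g) * D ≡⟨ square-*-comm b′ g D ⟩
      b′ * b′ * D * g * g   ∎))
      where
      open Relation.Binary.PropositionalEquality.≡-Reasoning
      square-* : ∀ x y → x * x * y * y ≡ (x * y) * (x * y)
      square-* = ℕ-solve-∀
      square-*-comm : ∀ x y z → (x * y) * (x * y) * z ≡ x * x * z * y * y
      square-*-comm = ℕ-solve-∀
    b′≡1 : b′ ≡ 1
    b′≡1 = coprime-/gcd a b
      (coprime-divisor (Coprimality.sym (coprime-/gcd a b)) (divides (b′ * D) (trans reduced (*-comm-middle b′ D))) , ∣-refl)
      where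
      *-comm-middle : ∀ x y → x * x * y ≡ x * y * x
      *-comm-middle = ℕ-solve-∀
    a′²≡D : a′ * a′ ≡ D
    a′²≡D = trans reduced (trans (cong (λ x → x * x * D) b′≡1) (*-identityˡ D))
    D≡1 : D ≡ 1
    D≡1 = trans (sym a′²≡D) (cong (λ x → x * x) (squareFree a′ (∣-reflexive a′²≡D)))

  squareFree⇒irrational : ∀ {D} → 2 ≤ D → SquareFree D → IrrationalSqrt (+ D)
  squareFree⇒irrational {D} D≥2 squareFree p q p²≡q²D = ∣i∣≡0⇒i≡0
    (squareFree⇒a²≡b²D⇒b≡0 D≥2 squareFree ∣ p ∣ ∣ q ∣ (begin
      ∣ p ∣ * ∣ p ∣          ≡⟨ sym (abs-* p p) ⟩
      ∣ p ℤ.* p ∣            ≡⟨ cong ∣_∣ p²≡q²D ⟩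
      ∣ q ℤ.* q ℤ.* + D ∣    ≡⟨ abs-* (q ℤ.* q) (+ D) ⟩
      ∣ q ℤ.* q ∣ * D        ≡⟨ cong (_* D) (abs-* q q) ⟩
      ∣ q ∣ * ∣ q ∣ * D      ∎))
    where open Relation.Binary.PropositionalEquality.≡-Reasoning

module IntegerInequalities where
  open import Data.Nat using (z≤n; s≤s)
  open import Data.Integer using (+0; +[1+_]; -[1+_]; -1ℤ; _+_; _*_; -_; _-_; _≤_; _<_; +≤+; +<+; -<+; _<?_)
  open import Data.Sum using (_⊎_; inj₁; inj₂)
  open import Data.Integer.Properties using (pos-*; <⇒≱; ≤⇒≯; <⇒≤; ≮⇒≥; neg-mono-<; neg-mono-≤; +-mono-≤; +-mono-≤-<
      ; +-mono-<-≤; +-monoˡ-<; +-inverseʳ; +-identityˡ; i<j⇒i≤pred[j])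
  open import Data.Integer.Tactic.RingSolver using (solve-∀)
  open import Relation.Nullary using (¬_; yes; no; contradiction)
  open import Relation.Binary.PropositionalEquality using (refl; subst; subst₂)

  0<-≡ : ∀ {i j} → 0ℤ < i → i ≡ j → 0ℤ < j
  0<-≡ 0<i refl = 0<i

  0≤-≡ : ∀ {i j} → 0ℤ ≤ i → i ≡ j → 0ℤ ≤ j
  0≤-≡ 0≤i refl = 0≤i

  *-nonNeg : ∀ {i j} → 0ℤ ≤ i → 0ℤ ≤ j → 0ℤ ≤ i * j
  *-nonNeg {+ m} {+ n} _ _ = subst (0ℤ ≤_) (pos-* m n) (+≤+ z≤n)

  *-pos : ∀ {i j} → 0ℤ < i → 0ℤ < j → 0ℤ < i * j
  *-pos {+[1+ m ]} {+[1+ n ]} _ _ = +<+ (s≤s z≤n)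
  *-pos {+0} (+<+ ()) _
  *-pos {+[1+ m ]} {+0} _ (+<+ ())

  +-nonNeg : ∀ n → 0ℤ ≤ + n
  +-nonNeg n = +≤+ z≤n

  square-nonNeg : ∀ i → 0ℤ ≤ i * i
  square-nonNeg (+ n)    = *-nonNeg (+-nonNeg n) (+-nonNeg n)
  square-nonNeg -[1+ n ] = subst (0ℤ ≤_) (pos-* (suc n) (suc n)) (+-nonNeg (suc n ℕ.* suc n))

  pos⇒¬nonNeg-neg : ∀ {i} → 0ℤ < i → ¬ 0ℤ ≤ - i
  pos⇒¬nonNeg-neg 0<i = <⇒≱ (neg-mono-< 0<i)

  nonNeg⊎neg : ∀ i → 0ℤ ≤ i ⊎ i < 0ℤ
  nonNeg⊎neg (+ n)    = inj₁ (+≤+ z≤n)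
  nonNeg⊎neg -[1+ n ] = inj₂ -<+

  nonNeg⇒¬pos-neg : ∀ {i} → 0ℤ ≤ i → ¬ 0ℤ < - i
  nonNeg⇒¬pos-neg 0≤i = ≤⇒≯ (neg-mono-≤ 0≤i)

  root-dominance : ∀ {a b} → 0ℤ ≤ b → 0ℤ < b * b - a * a → 0ℤ < b - a
  root-dominance {a} {b} 0≤b 0<b²-a² with 0ℤ <? b - a
  ... | yes 0<b-a = 0<b-a
  ... | no  0≮b-a = contradiction
    (0≤-≡ (*-nonNeg 0≤a-b (+-mono-≤ 0≤a-b (+-mono-≤ 0≤b 0≤b))) (factor a b))
    (pos⇒¬nonNeg-neg 0<b²-a²)
    where
    0≤a-b : 0ℤ ≤ - (b - a)
    0≤a-b = neg-mono-≤ (≮⇒≥ 0≮b-a)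
    factor : ∀ a b → - (b - a) * (- (b - a) + (b + b)) ≡ - (b * b - a * a)
    factor = solve-∀

  square-dominance : ∀ {a b} → 0ℤ ≤ b → 0ℤ < b * b - a * a → 0ℤ < b - a × 0ℤ < b + a
  square-dominance {a} {b} 0≤b 0<b²-a² =
    root-dominance 0≤b 0<b²-a² , 0<-≡ (root-dominance 0≤b (0<-≡ 0<b²-a² (negate-square a b))) (minus-neg a b)
    where
    negate-square : ∀ a b → b * b - a * a ≡ b * b - (- a) * (- a)
    negate-square = solve-∀
    minus-neg : ∀ a b → b - - a ≡ b + a
    minus-neg = solve-∀

  <⇒0<- : ∀ {i j} → i < j → 0ℤ < j - i
  <⇒0<- {i} {j} i<j = subst (_< j - i) (+-inverseʳ i) (+-monoˡ-< (- i) i<j)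

  0<-⇒< : ∀ {i j} → 0ℤ < j - i → i < j
  0<-⇒< {i} {j} 0<j-i = subst₂ _<_ (+-identityˡ i) (cancel i j) (+-monoˡ-< i 0<j-i)
    where
    cancel : ∀ i j → j - i + i ≡ j
    cancel = solve-∀

  0<1+j-i⇒i≤j : ∀ {i j} → 0ℤ < + 1 + j - i → i ≤ j
  0<1+j-i⇒i≤j {i} {j} 0<1+j-i = subst (i ≤_) (cancel j) (i<j⇒i≤pred[j] (0<-⇒< {i} {+ 1 + j} 0<1+j-i))
    where
    cancel : ∀ j → -1ℤ + (+ 1 + j) ≡ j
    cancel = solve-∀

  0<k*i⇒0<i : ∀ {k i} → 0ℤ ≤ k → 0ℤ < k * i → 0ℤ < i
  0<k*i⇒0<i {k} {i} 0≤k 0<ki with 0ℤ <? i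
  ... | yes 0<i = 0<i
  ... | no  0≮i = contradiction (0≤-≡ (*-nonNeg 0≤k (neg-mono-≤ (≮⇒≥ 0≮i))) (neg-distribʳ k i)) (pos⇒¬nonNeg-neg 0<ki)
    where
    neg-distribʳ : ∀ k i → k * - i ≡ - (k * i)
    neg-distribʳ = solve-∀

  *-mono-<-nonNeg : ∀ a b c d → 0ℤ ≤ a → 0ℤ < b - a → 0ℤ ≤ c → 0ℤ < d - c → 0ℤ < b * d - a * c
  *-mono-<-nonNeg a b c d 0≤a 0<b-a 0≤c 0<d-c =
    0<-≡ (+-mono-≤-< (*-nonNeg (<⇒≤ 0<b-a) 0≤c) (*-pos (+-mono-<-≤ 0<b-a 0≤a) 0<d-c)) (expand a b c d)
    where
    expand : ∀ a b c d → (b - a) * c + ((b - a) + a) * (d - c) ≡ b * d - a * c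
    expand = solve-∀

module QuadraticCone (d : ℤ) (0≤d : 0ℤ ℤ.≤ d) (irrational : IrrationalSqrt d) where
  open import Data.Nat as ℕ using (ℕ; z≤n; s≤s)
  open import Data.Integer using (+0; +[1+_]; -[1+_]; _+_; _*_; -_; _-_; _≤_; _<_; +<+; +≤+)
  open import Data.Integer.Properties using (<-cmp; <⇒≤; <⇒≢; <⇒≱; neg-mono-<; +-mono-<; +-mono-≤-<; +-comm; +-identityʳ
      ; pos-+; pos-*; i≤j⇒0≤j-i; i<j⇒suc[i]≤j; i*j≡0⇒i≡0∨j≡0; i-j≡0⇒i≡j)
  open import Data.Integer.Tactic.RingSolver using (solve; solve-∀)
  open import Data.List using (_∷_; [])
  open import Data.Sum using (_⊎_; inj₁; inj₂; [_,_])
  open import Data.Empty using (⊥-elim)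
  open import Function using (id)
  open import Relation.Nullary using (¬_; contradiction)
  open import Relation.Binary using (tri<; tri≈; tri>)
  open import Relation.Binary.PropositionalEquality using (refl; sym; trans; cong; cong₂; subst)
  open IntegerInequalities

  -- (p , q) stands for p + q √d, which is positive exactly when its larger summand is.
  data Positive : ℤ × ℤ → Set where
    rational-dominant : ∀ {p q} → 0ℤ < p → 0ℤ < p * p - q * q * d → Positive (p , q)
    surd-dominant     : ∀ {p q} → 0ℤ < q → 0ℤ < q * q * d - p * p → Positive (p , q)

  Positive-≡ : ∀ {v w} → Positive v → v ≡ w → Positive w
  Positive-≡ v>0 refl = v>0

  ¬Positive-0 : ¬ Positive (0ℤ , 0ℤ)
  ¬Positive-0 (rational-dominant (+<+ ()) _)
  ¬Positive-0 (surd-dominant (+<+ ()) _)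

  Positive-asym : ∀ {v} → Positive v → ¬ Positive (⊝ v)
  Positive-asym (rational-dominant 0<p _) (rational-dominant 0<-p _) = pos⇒¬nonNeg-neg 0<p (<⇒≤ 0<-p)
  Positive-asym (surd-dominant 0<q _) (surd-dominant 0<-q _) = pos⇒¬nonNeg-neg 0<q (<⇒≤ 0<-q)
  Positive-asym {p , q} (rational-dominant _ N>0) (surd-dominant _ M>0) =
    pos⇒¬nonNeg-neg N>0 (<⇒≤ (0<-≡ M>0 (solve (p ∷ q ∷ d ∷ []))))
  Positive-asym {p , q} (surd-dominant _ M>0) (rational-dominant _ N>0) =
    pos⇒¬nonNeg-neg M>0 (<⇒≤ (0<-≡ N>0 (solve (p ∷ q ∷ d ∷ []))))

  private
    norm-neg : ∀ p q → p * p - q * q * d ≡ (- p) * (- p) - (- q) * (- q) * d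
    norm-neg p q = solve (p ∷ q ∷ d ∷ [])
    norm-0 : ∀ q → q * q * d ≡ - (0ℤ * 0ℤ - q * q * d)
    norm-0 q = solve (q ∷ d ∷ [])
    norm-swap : ∀ p q → - (p * p - q * q * d) ≡ q * q * d - p * p
    norm-swap p q = solve (p ∷ q ∷ d ∷ [])
    norm-swap-neg : ∀ p q → - (p * p - q * q * d) ≡ (- q) * (- q) * d - (- p) * (- p)
    norm-swap-neg p q = solve (p ∷ q ∷ d ∷ [])
    norm-0′ : ∀ p → p * p - 0ℤ * 0ℤ * d ≡ p * p
    norm-0′ p = solve (p ∷ d ∷ [])

  Positive-trichotomy : ∀ v → Positive v ⊎ Positive (⊝ v) ⊎ v ≡ (0ℤ , 0ℤ)
  Positive-trichotomy (p , q) with <-cmp 0ℤ (p * p - q * q * d)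
  ... | tri< 0<N _ _ with <-cmp 0ℤ p
  ...   | tri< 0<p _ _  = inj₁ (rational-dominant 0<p 0<N)
  ...   | tri> _ _ p<0  = inj₂ (inj₁ (rational-dominant (neg-mono-< p<0) (0<-≡ 0<N (norm-neg p q))))
  ...   | tri≈ _ refl _ = contradiction (0≤-≡ (*-nonNeg (square-nonNeg q) 0≤d) (norm-0 q)) (pos⇒¬nonNeg-neg 0<N)
  Positive-trichotomy (p , q) | tri> _ _ N<0 with <-cmp 0ℤ q
  ...   | tri< 0<q _ _  = inj₁ (surd-dominant 0<q (0<-≡ (neg-mono-< N<0) (norm-swap p q)))
  ...   | tri> _ _ q<0  = inj₂ (inj₁ (surd-dominant (neg-mono-< q<0) (0<-≡ (neg-mono-< N<0) (norm-swap-neg p q))))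
  ...   | tri≈ _ refl _ = contradiction (0≤-≡ (square-nonNeg p) (sym (norm-0′ p))) (<⇒≱ N<0)
  Positive-trichotomy (p , q) | tri≈ _ 0≡N _ = inj₂ (inj₂ (cong₂ _,_ p≡0 q≡0))
    where
    q≡0 : q ≡ 0ℤ
    q≡0 = irrational p q (i-j≡0⇒i≡j _ _ (sym 0≡N))
    p≡0 : p ≡ 0ℤ
    p≡0 = [ id , id ] (i*j≡0⇒i≡0∨j≡0 p (trans (i-j≡0⇒i≡j _ _ (sym 0≡N)) (cong (λ x → x * x * d) q≡0)))


  private
    0≤q²d : ∀ q → 0ℤ ≤ q * q * d
    0≤q²d q = *-nonNeg (square-nonNeg q) 0≤d

    rational-cross : ∀ p q r s → 0ℤ < p → 0ℤ < p * p - q * q * d → 0ℤ < r → 0ℤ < r * r - s * s * d →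
                     0ℤ < p * r - q * s * d × 0ℤ < p * r + q * s * d
    rational-cross p q r s 0<p N₁ 0<r N₂ = square-dominance {q * s * d} (*-nonNeg (<⇒≤ 0<p) (<⇒≤ 0<r))
      (0<-≡ (*-mono-<-nonNeg (q * q * d) (p * p) (s * s * d) (r * r) (0≤q²d q) N₁ (0≤q²d s) N₂)
            (solve (p ∷ q ∷ r ∷ s ∷ d ∷ [])))

    surd-cross : ∀ p q r s → 0ℤ < q → 0ℤ < q * q * d - p * p → 0ℤ < s → 0ℤ < s * s * d - r * r →
                 0ℤ < q * s * d - p * r × 0ℤ < q * s * d + p * r
    surd-cross p q r s 0<q M₁ 0<s M₂ = square-dominance {p * r} (*-nonNeg (*-nonNeg (<⇒≤ 0<q) (<⇒≤ 0<s)) 0≤d)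
      (0<-≡ (*-mono-<-nonNeg (p * p) (q * q * d) (r * r) (s * s * d) (square-nonNeg p) M₁ (square-nonNeg r) M₂)
            (solve (p ∷ q ∷ r ∷ s ∷ d ∷ [])))

    sum-of-three : ∀ {a b c} → 0ℤ < a → 0ℤ < b → 0ℤ < c → 0ℤ < a + b + (c + c)
    sum-of-three 0<a 0<b 0<c = +-mono-< (+-mono-< 0<a 0<b) (+-mono-< 0<c 0<c)

    rational-+ : ∀ p q r s → 0ℤ < p → 0ℤ < p * p - q * q * d → 0ℤ < r → 0ℤ < r * r - s * s * d →
                 Positive (p + r , q + s)
    rational-+ p q r s 0<p N₁ 0<r N₂ = rational-dominant (+-mono-< 0<p 0<r)
      (0<-≡ (sum-of-three N₁ N₂ (proj₁ (rational-cross p q r s 0<p N₁ 0<r N₂))) (solve (p ∷ q ∷ r ∷ s ∷ d ∷ [])))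

    surd-+ : ∀ p q r s → 0ℤ < q → 0ℤ < q * q * d - p * p → 0ℤ < s → 0ℤ < s * s * d - r * r →
             Positive (p + r , q + s)
    surd-+ p q r s 0<q M₁ 0<s M₂ = surd-dominant (+-mono-< 0<q 0<s)
      (0<-≡ (sum-of-three M₁ M₂ (proj₁ (surd-cross p q r s 0<q M₁ 0<s M₂))) (solve (p ∷ q ∷ r ∷ s ∷ d ∷ [])))

    neg-+-cancelʳ : ∀ a b → - (a + b) + a ≡ - b
    neg-+-cancelʳ a b = solve (a ∷ b ∷ [])

    neg-+-cancelˡ : ∀ a b → - (a + b) + b ≡ - a
    neg-+-cancelˡ a b = solve (a ∷ b ∷ [])

    +≡0⇒≡neg : ∀ a b → a + b ≡ 0ℤ → b ≡ - a
    +≡0⇒≡neg a b a+b≡0 = begin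
      b             ≡⟨ solve (a ∷ b ∷ []) ⟩
      - a + (a + b) ≡⟨ cong (λ x → - a + x) a+b≡0 ⟩
      - a + 0ℤ      ≡⟨ +-identityʳ (- a) ⟩
      - a           ∎
      where open Relation.Binary.PropositionalEquality.≡-Reasoning

    -- A sum of opposite types cannot be negative or zero: otherwise its negation would
    -- combine with the summand of the same type into the negation of the other summand.
    mixed-+ : ∀ p q r s → 0ℤ < p → 0ℤ < p * p - q * q * d → 0ℤ < s → 0ℤ < s * s * d - r * r →
              Positive (p + r , q + s)
    mixed-+ p q r s 0<p N₁ 0<s M₂ with Positive-trichotomy (p + r , q + s)
    ... | inj₁ v+w>0 = v+w>0
    ... | inj₂ (inj₁ (rational-dominant 0<a N)) = ⊥-elim (Positive-asym (surd-dominant 0<s M₂)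
          (Positive-≡ (rational-+ (- (p + r)) (- (q + s)) p q 0<a N 0<p N₁) (cong₂ _,_ (neg-+-cancelʳ p r) (neg-+-cancelʳ q s))))
    ... | inj₂ (inj₁ (surd-dominant 0<b M)) = ⊥-elim (Positive-asym (rational-dominant 0<p N₁)
          (Positive-≡ (surd-+ (- (p + r)) (- (q + s)) r s 0<b M 0<s M₂) (cong₂ _,_ (neg-+-cancelˡ p r) (neg-+-cancelˡ q s))))
    ... | inj₂ (inj₂ v+w≡0) = ⊥-elim (Positive-asym (rational-dominant 0<p N₁)
          (Positive-≡ (surd-dominant 0<s M₂)
            (cong₂ _,_ (+≡0⇒≡neg p r (cong proj₁ v+w≡0)) (+≡0⇒≡neg q s (cong proj₂ v+w≡0)))))

  Positive-+ : ∀ {v w} → Positive v → Positive w → Positive (v ⊕ w)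
  Positive-+ {p , q} {r , s} (rational-dominant 0<p N₁) (rational-dominant 0<r N₂) = rational-+ p q r s 0<p N₁ 0<r N₂
  Positive-+ {p , q} {r , s} (surd-dominant 0<q M₁) (surd-dominant 0<s M₂) = surd-+ p q r s 0<q M₁ 0<s M₂
  Positive-+ {p , q} {r , s} (rational-dominant 0<p N₁) (surd-dominant 0<s M₂) = mixed-+ p q r s 0<p N₁ 0<s M₂
  Positive-+ {p , q} {r , s} (surd-dominant 0<q M₁) (rational-dominant 0<r N₂) =
    Positive-≡ (mixed-+ r s p q 0<r N₂ 0<q M₁) (cong₂ _,_ (+-comm r p) (+-comm s q))

  infixl 25 _⊛_
  _⊛_ : ℤ × ℤ → ℤ × ℤ → ℤ × ℤ
  (p , q) ⊛ (r , s) = (p * r + q * s * d , p * s + q * r)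

  private
    mixed-* : ∀ p q r s → 0ℤ < p → 0ℤ < p * p - q * q * d → 0ℤ < s → 0ℤ < s * s * d - r * r →
              Positive ((p , q) ⊛ (r , s))
    mixed-* p q r s 0<p N₁ 0<s M₂ = surd-dominant (proj₂ (square-dominance {q * r} 0≤ps 0<[ps]²-[qr]²))
      (0<-≡ (*-pos N₁ M₂) (solve (p ∷ q ∷ r ∷ s ∷ d ∷ [])))
      where
      0≤ps : 0ℤ ≤ p * s
      0≤ps = *-nonNeg (<⇒≤ 0<p) (<⇒≤ 0<s)
      0<[ps]²-[qr]² : 0ℤ < p * s * (p * s) - q * r * (q * r)
      0<[ps]²-[qr]² = 0<k*i⇒0<i 0≤d
        (0<-≡ (*-mono-<-nonNeg (q * q * d) (p * p) (r * r) (s * s * d) (0≤q²d q) N₁ (square-nonNeg r) M₂)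
              (solve (p ∷ q ∷ r ∷ s ∷ d ∷ [])))

  Positive-* : ∀ {v w} → Positive v → Positive w → Positive (v ⊛ w)
  Positive-* {p , q} {r , s} (rational-dominant 0<p N₁) (rational-dominant 0<r N₂) =
    rational-dominant (proj₂ (rational-cross p q r s 0<p N₁ 0<r N₂))
                      (0<-≡ (*-pos N₁ N₂) (solve (p ∷ q ∷ r ∷ s ∷ d ∷ [])))
  Positive-* {p , q} {r , s} (surd-dominant 0<q M₁) (surd-dominant 0<s M₂) =
    rational-dominant (0<-≡ (proj₂ (surd-cross p q r s 0<q M₁ 0<s M₂)) (+-comm (q * s * d) (p * r)))
                      (0<-≡ (*-pos M₁ M₂) (solve (p ∷ q ∷ r ∷ s ∷ d ∷ [])))
  Positive-* {p , q} {r , s} (rational-dominant 0<p N₁) (surd-dominant 0<s M₂) = mixed-* p q r s 0<p N₁ 0<s M₂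
  Positive-* {p , q} {r , s} (surd-dominant 0<q M₁) (rational-dominant 0<r N₂) =
    Positive-≡ (mixed-* r s p q 0<r N₂ 0<q M₁)
               (cong₂ _,_ (solve (p ∷ q ∷ r ∷ s ∷ d ∷ [])) (solve (p ∷ q ∷ r ∷ s ∷ [])))

  nonNeg-pair : ∀ {p q} → 0ℤ ≤ p → 0ℤ ≤ q → (p , q) ≢ (0ℤ , 0ℤ) → Positive (p , q)
  nonNeg-pair {p} {q} 0≤p 0≤q ≢0 with Positive-trichotomy (p , q)
  ... | inj₁ v>0                                = v>0
  ... | inj₂ (inj₁ (rational-dominant 0<-p _)) = contradiction 0<-p (nonNeg⇒¬pos-neg 0≤p)
  ... | inj₂ (inj₁ (surd-dominant 0<-q _))     = contradiction 0<-q (nonNeg⇒¬pos-neg 0≤q)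
  ... | inj₂ (inj₂ ≡0)                          = contradiction ≡0 ≢0

  Positive-⊙ : ∀ {n v} → 0ℤ < n → Positive v → Positive (n ⊙ v)
  Positive-⊙ {n} {p , q} 0<n (rational-dominant 0<p N) =
    rational-dominant (*-pos 0<n 0<p) (0<-≡ (*-pos (*-pos 0<n 0<n) N) (solve (n ∷ p ∷ q ∷ d ∷ [])))
  Positive-⊙ {n} {p , q} 0<n (surd-dominant 0<q M) =
    surd-dominant (*-pos 0<n 0<q) (0<-≡ (*-pos (*-pos 0<n 0<n) M) (solve (n ∷ p ∷ q ∷ d ∷ [])))

  Positive-half : ∀ {v} → Positive (v ⊕ v) → Positive v
  Positive-half {p , q} (rational-dominant 0<2p N) = rational-dominant
    (0<k*i⇒0<i {+ 2} (+≤+ z≤n) (0<-≡ 0<2p (solve (p ∷ []))))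
    (0<k*i⇒0<i {+ 4} (+≤+ z≤n) (0<-≡ N (solve (p ∷ q ∷ d ∷ []))))
  Positive-half {p , q} (surd-dominant 0<2q M) = surd-dominant
    (0<k*i⇒0<i {+ 2} (+≤+ z≤n) (0<-≡ 0<2q (solve (q ∷ []))))
    (0<k*i⇒0<i {+ 4} (+≤+ z≤n) (0<-≡ M (solve (p ∷ q ∷ d ∷ []))))

  private
    surd-archimedean : ∀ m q → Positive (- + m , q) → Positive ((+ (4 ℕ.* m ℕ.+ 4)) ⊙ (- + m , q) ⊖ (+ 2 , 0ℤ))
    surd-archimedean m q (rational-dominant 0<-m _) = contradiction 0<-m (nonNeg⇒¬pos-neg (+-nonNeg m))
    surd-archimedean m q (surd-dominant 0<q 0<X) = Positive-≡ (surd-dominant 0<nq 0<norm) (cong₂ _,_ refl (sym (+-identityʳ _)))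
      where
      n : ℤ
      n = + 4 * + m + + 4
      n≡ : + (4 ℕ.* m ℕ.+ 4) ≡ n
      n≡ = trans (pos-+ (4 ℕ.* m) 4) (cong (_+ + 4) (pos-* 4 m))
      0<n : 0ℤ < n
      0<n = +-mono-≤-< (*-nonNeg (+-nonNeg 4) (+-nonNeg m)) (+<+ (s≤s z≤n))
      0<nq : 0ℤ < + (4 ℕ.* m ℕ.+ 4) * q
      0<nq = subst (λ k → 0ℤ < k * q) (sym n≡) (*-pos 0<n 0<q)
      0<norm : 0ℤ < (+ (4 ℕ.* m ℕ.+ 4) * q) * (+ (4 ℕ.* m ℕ.+ 4) * q) * d
                    - (+ (4 ℕ.* m ℕ.+ 4) * - + m + - + 2) * (+ (4 ℕ.* m ℕ.+ 4) * - + m + - + 2)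
      0<norm = subst (λ k → 0ℤ < (k * q) * (k * q) * d - (k * - + m + - + 2) * (k * - + m + - + 2)) (sym n≡)
        (0<-≡ (+-mono-≤-< (*-nonNeg (square-nonNeg n) (i≤j⇒0≤j-i (i<j⇒suc[i]≤j 0<X)))
                          (+-mono-≤-< (*-nonNeg (+-nonNeg 16) (+-nonNeg m)) (+<+ (s≤s (z≤n {11})))))
              (expand (+ m) q))
        where
        expand : ∀ m q → (+ 4 * m + + 4) * (+ 4 * m + + 4) * (q * q * d - (- m) * (- m) - + 1) + (+ 16 * m + + 12)
                         ≡ ((+ 4 * m + + 4) * q) * ((+ 4 * m + + 4) * q) * d
                           - ((+ 4 * m + + 4) * - m + - + 2) * ((+ 4 * m + + 4) * - m + - + 2)
        expand m q = solve (m ∷ q ∷ d ∷ [])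

  Positive-archimedean : ∀ {p q} → Positive (p , q) → 0ℤ ≤ q → Σ ℕ λ n → Positive ((+ n) ⊙ (p , q) ⊖ (+ 2 , 0ℤ))
  Positive-archimedean {+[1+ k ]} {q} _ 0≤q =
    3 , nonNeg-pair (<⇒≤ 0<first) (0≤-≡ (*-nonNeg (+-nonNeg 3) 0≤q) (sym (+-identityʳ _)))
                    λ eq → <⇒≢ 0<first (sym (cong proj₁ eq))
    where
    0<first : 0ℤ < + 3 * +[1+ k ] + - + 2
    0<first = 0<-≡ (+-mono-≤-< (*-nonNeg (+-nonNeg 3) (+-nonNeg k)) (+<+ (s≤s (z≤n {0})))) (expand (+ k))
      where
      expand : ∀ k → + 3 * k + + 1 ≡ + 3 * (+ 1 + k) + - + 2
      expand = solve-∀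
  Positive-archimedean {+0}       {q} v>0 _ = 4 , surd-archimedean 0 q v>0
  Positive-archimedean { -[1+ k ]} {q} v>0 _ = 4 ℕ.* suc k ℕ.+ 4 , surd-archimedean (suc k) q v>0

module RealEmbedding (D : ℕ) (irrational : IrrationalSqrt (+ D)) where
  open import Data.Nat using (z≤n; s≤s; _∸_; _/_; _%_)
  open import Data.Nat.Properties using (≡ᵇ⇒≡; m+n∸m≡n)
  open import Data.Nat.DivMod using (m≡m%n+[m/n]*n; m*n/n≡m)
  open import Data.Bool using (Bool; true; false; T; not; _∧_; _∨_; if_then_else_)
  open import Data.Bool.Properties using (T-∧; T-∨)
  open import Data.Product.Properties using (≡-dec)
  open import Data.Integer using (+0; +[1+_]; _+_; _*_; -_; _-_; _≤_; _<_; +≤+; +<+; _≤?_; _<?_; _≟_)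
  open import Data.Integer.Properties using (<⇒≤; <⇒≢; pos-+; pos-*; *-identityˡ; *-identityʳ; *-zeroʳ; +-identityʳ
      ; *-distribˡ-+; neg-distribʳ-*; i*j≡0⇒i≡0∨j≡0; neg-distrib-+; +-mono-<-≤)
  open import Data.Integer.Tactic.RingSolver using (solve-∀; solve)
  open import Data.Nat.Tactic.RingSolver using () renaming (solve-∀ to ℕ-solve-∀)
  open import Data.List using (_∷_; [])
  open import Data.Sum using (_⊎_; inj₁; inj₂)
  open import Data.Unit using (tt)
  open import Function.Bundles using (Equivalence)
  open import Relation.Nullary using (¬_; Dec; contradiction)
  open import Relation.Nullary.Decidable using (⌊_⌋; T?; map′; _⊎-dec_; toWitness; fromWitness; fromWitnessFalse)
  open import Relation.Binary.PropositionalEquality using (refl; sym; trans; cong; cong₂; subst; ≢-sym; module ≡-Reasoning)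
  open Equivalence using (to; from)
  open IntegerInequalities
  open QuadraticCone (+ D) (+≤+ z≤n) irrational public

  private
    both-nonNeg rational-wins surd-wins : ℤ → ℤ → Bool
    both-nonNeg   p q = ⌊ 0ℤ ≤? p ⌋ ∧ ⌊ 0ℤ ≤? q ⌋ ∧ not (⌊ p ≟ 0ℤ ⌋ ∧ ⌊ q ≟ 0ℤ ⌋)
    rational-wins p q = ⌊ 0ℤ <? p ⌋ ∧ ⌊ q <? 0ℤ ⌋ ∧ ⌊ q * q * + D <? p * p ⌋
    surd-wins     p q = ⌊ p <? 0ℤ ⌋ ∧ ⌊ 0ℤ <? q ⌋ ∧ ⌊ p * p <? q * q * + D ⌋

    not-∧ˡ : ∀ {a b} → T (not a) → T (not (a ∧ b))
    not-∧ˡ {false} _ = tt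

    not-∧ʳ : ∀ {a b} → T (not b) → T (not (a ∧ b))
    not-∧ʳ {false} _ = tt
    not-∧ʳ {true}  h = h

    posPQ-nonNeg : ∀ {p q} → 0ℤ ≤ p → 0ℤ ≤ q → p ≢ 0ℤ ⊎ q ≢ 0ℤ → T (posPQ D p q)
    posPQ-nonNeg {p} {q} 0≤p 0≤q ≢0 = from (T-∨ {both-nonNeg p q} {rational-wins p q ∨ surd-wins p q})
      (inj₁ (from (T-∧ {⌊ 0ℤ ≤? p ⌋}) (fromWitness 0≤p , from (T-∧ {⌊ 0ℤ ≤? q ⌋}) (fromWitness 0≤q , not-both ≢0))))
      where
      not-both : p ≢ 0ℤ ⊎ q ≢ 0ℤ → T (not (⌊ p ≟ 0ℤ ⌋ ∧ ⌊ q ≟ 0ℤ ⌋))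
      not-both (inj₁ p≢0) = not-∧ˡ {⌊ p ≟ 0ℤ ⌋} (fromWitnessFalse p≢0)
      not-both (inj₂ q≢0) = not-∧ʳ {⌊ p ≟ 0ℤ ⌋} (fromWitnessFalse q≢0)

    posPQ-rational : ∀ {p q} → 0ℤ < p → q < 0ℤ → q * q * + D < p * p → T (posPQ D p q)
    posPQ-rational {p} {q} 0<p q<0 q²D<p² = from (T-∨ {both-nonNeg p q}) (inj₂ (from (T-∨ {rational-wins p q}) (inj₁
      (from (T-∧ {⌊ 0ℤ <? p ⌋}) (fromWitness 0<p , from (T-∧ {⌊ q <? 0ℤ ⌋}) (fromWitness q<0 , fromWitness q²D<p²))))))

    posPQ-surd : ∀ {p q} → p < 0ℤ → 0ℤ < q → p * p < q * q * + D → T (posPQ D p q)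
    posPQ-surd {p} {q} p<0 0<q p²<q²D = from (T-∨ {both-nonNeg p q}) (inj₂ (from (T-∨ {rational-wins p q}) (inj₂
      (from (T-∧ {⌊ p <? 0ℤ ⌋}) (fromWitness p<0 , from (T-∧ {⌊ 0ℤ <? q ⌋}) (fromWitness 0<q , fromWitness p²<q²D))))))

  posPQ⇒Positive : ∀ p q → T (posPQ D p q) → Positive (p , q)
  posPQ⇒Positive p q h with to (T-∨ {both-nonNeg p q}) h
  ... | inj₁ h₁ with to (T-∧ {⌊ 0ℤ ≤? p ⌋}) h₁
  ...   | 0≤p , h₂ with to (T-∧ {⌊ 0ℤ ≤? q ⌋}) h₂
  ...     | 0≤q , ≢0 = nonNeg-pair (toWitness 0≤p) (toWitness 0≤q) λ { refl → ≢0 }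
  posPQ⇒Positive p q h | inj₂ h₁ with to (T-∨ {rational-wins p q}) h₁
  ... | inj₁ h₂ with to (T-∧ {⌊ 0ℤ <? p ⌋}) h₂
  ...   | 0<p , h₃ = rational-dominant (toWitness 0<p) (<⇒0<- (toWitness (proj₂ (to (T-∧ {⌊ q <? 0ℤ ⌋}) h₃))))
  posPQ⇒Positive p q h | inj₂ h₁ | inj₂ h₂ with to (T-∧ {⌊ p <? 0ℤ ⌋}) h₂
  ...   | _ , h₃ with to (T-∧ {⌊ 0ℤ <? q ⌋}) h₃
  ...     | 0<q , p²<q²D = surd-dominant (toWitness 0<q) (<⇒0<- (toWitness p²<q²D))

  Positive⇒posPQ : ∀ p q → Positive (p , q) → T (posPQ D p q)
  Positive⇒posPQ p q (rational-dominant 0<p N>0) with nonNeg⊎neg q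
  ... | inj₁ 0≤q = posPQ-nonNeg (<⇒≤ 0<p) 0≤q (inj₁ (≢-sym (<⇒≢ 0<p)))
  ... | inj₂ q<0 = posPQ-rational 0<p q<0 (0<-⇒< N>0)
  Positive⇒posPQ p q (surd-dominant 0<q M>0) with nonNeg⊎neg p
  ... | inj₁ 0≤p = posPQ-nonNeg 0≤p (<⇒≤ 0<q) (inj₂ (≢-sym (<⇒≢ 0<q)))
  ... | inj₂ p<0 = posPQ-surd p<0 0<q (0<-⇒< M>0)

  -- O_K = ℤ[ω] with ω² = t ω + K, and 2 (a + b ω) = (2a + t b) + s b √D.
  t s K : ℤ
  t = if isOneMod4 D then + 1 else + 0
  s = if isOneMod4 D then + 1 else + 2
  K = if isOneMod4 D then + ((D ∸ 1) / 4) else + D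

  ⟦_⟧ : OK → ℤ × ℤ
  ⟦ a , b ⟧ = (+ 2 * a + t * b , s * b)

  twice≡⟦⟧ : ∀ x → twice D x ≡ ⟦ x ⟧
  twice≡⟦⟧ (a , b) with isOneMod4 D
  ... | true  = cong₂ _,_ (cong (λ x → + 2 * a + x) (sym (*-identityˡ b))) (sym (*-identityˡ b))
  ... | false = cong₂ _,_ (sym (+-identityʳ (+ 2 * a))) refl

  mul≡ : ∀ a b c d → mul D (a , b) (c , d) ≡ (a * c + b * d * K , a * d + b * c + b * d * t)
  mul≡ a b c d with isOneMod4 D
  ... | true  = cong₂ _,_ refl (cong (λ x → a * d + b * c + x) (sym (*-identityʳ (b * d))))
  ... | false = cong₂ _,_ refl (sym (trans (cong (λ x → a * d + b * c + x) (*-zeroʳ (b * d))) (+-identityʳ _)))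

  conj≡ : ∀ a b → conj D (a , b) ≡ (a + t * b , - b)
  conj≡ a b with isOneMod4 D
  ... | true  = cong₂ _,_ (cong (λ x → a + x) (sym (*-identityˡ b))) refl
  ... | false = cong₂ _,_ (sym (+-identityʳ a)) refl

  ξ≡ : ξ D ≡ (- t , + 1)
  ξ≡ with isOneMod4 D
  ... | true  = refl
  ... | false = refl

  4K+t²≡s²D : + 4 * K + t * t ≡ s * s * + D
  4K+t²≡s²D with isOneMod4 D in oneMod4
  ... | true  = lift {(D ∸ 1) / 4} (≡4k+1 (≡ᵇ⇒≡ (D % 4) 1 (subst T (sym oneMod4) tt)))
    where
    ≡4k+1 : D % 4 ≡ 1 → 4 ℕ.* ((D ∸ 1) / 4) ℕ.+ 1 ≡ D
    ≡4k+1 D%4≡1 = begin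
      4 ℕ.* ((D ∸ 1) / 4) ℕ.+ 1           ≡⟨ cong (λ n → 4 ℕ.* ((n ∸ 1) / 4) ℕ.+ 1) D≡1+q*4 ⟩
      4 ℕ.* ((1 ℕ.+ q ℕ.* 4 ∸ 1) / 4) ℕ.+ 1 ≡⟨ cong (λ n → 4 ℕ.* (n / 4) ℕ.+ 1) (m+n∸m≡n 1 (q ℕ.* 4)) ⟩
      4 ℕ.* (q ℕ.* 4 / 4) ℕ.+ 1           ≡⟨ cong (λ n → 4 ℕ.* n ℕ.+ 1) (m*n/n≡m q 4) ⟩
      4 ℕ.* q ℕ.+ 1                       ≡⟨ ℕ-rearrange q ⟩
      1 ℕ.+ q ℕ.* 4                       ≡⟨ sym D≡1+q*4 ⟩
      D                                   ∎
      where
      open ≡-Reasoning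
      q : ℕ
      q = D / 4
      D≡1+q*4 : D ≡ 1 ℕ.+ q ℕ.* 4
      D≡1+q*4 = trans (m≡m%n+[m/n]*n D 4) (cong (ℕ._+ q ℕ.* 4) D%4≡1)
      ℕ-rearrange : ∀ q → 4 ℕ.* q ℕ.+ 1 ≡ 1 ℕ.+ q ℕ.* 4
      ℕ-rearrange = ℕ-solve-∀
    lift : ∀ {k n} → 4 ℕ.* k ℕ.+ 1 ≡ n → + 4 * + k + + 1 * + 1 ≡ + 1 * + 1 * + n
    lift {k} refl = begin
      + 4 * + k + + 1 * + 1       ≡⟨ cong (_+ + 1) (sym (pos-* 4 k)) ⟩
      + (4 ℕ.* k) + + 1           ≡⟨ sym (pos-+ (4 ℕ.* k) 1) ⟩
      + (4 ℕ.* k ℕ.+ 1)           ≡⟨ sym (*-identityˡ _) ⟩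
      + 1 * + 1 * + (4 ℕ.* k ℕ.+ 1) ∎
      where open ≡-Reasoning
  ... | false = scale D
    where
    scale : ∀ n → + 4 * + n + 0ℤ * 0ℤ ≡ + 2 * + 2 * + n
    scale n = trans (+-identityʳ (+ 4 * + n)) refl

  0≤t : 0ℤ ≤ t
  0≤t with isOneMod4 D
  ... | true  = +≤+ z≤n
  ... | false = +≤+ z≤n

  0<s : 0ℤ < s
  0<s with isOneMod4 D
  ... | true  = +<+ (s≤s z≤n)
  ... | false = +<+ (s≤s z≤n)

  Pos⇒Positive : ∀ x → Pos D x → Positive ⟦ x ⟧
  Pos⇒Positive x x>0 = Positive-≡ (posPQ⇒Positive _ _ x>0) (twice≡⟦⟧ x)

  Positive⇒Pos : ∀ x → Positive ⟦ x ⟧ → Pos D x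
  Positive⇒Pos x ⟦x⟧>0 = Positive⇒posPQ _ _ (Positive-≡ ⟦x⟧>0 (sym (twice≡⟦⟧ x)))

  ⟦⟧-⊕ : ∀ x y → ⟦ x ⊕ y ⟧ ≡ ⟦ x ⟧ ⊕ ⟦ y ⟧
  ⟦⟧-⊕ (a , b) (c , d) = cong₂ _,_ (linear a b c d t) (*-distribˡ-+ s b d)
    where
    linear : ∀ a b c d t → + 2 * (a + c) + t * (b + d) ≡ (+ 2 * a + t * b) + (+ 2 * c + t * d)
    linear = solve-∀

  ⟦⟧-⊝ : ∀ x → ⟦ ⊝ x ⟧ ≡ ⊝ ⟦ x ⟧
  ⟦⟧-⊝ (a , b) = cong₂ _,_ (negate a b t) (sym (neg-distribʳ-* s b))
    where
    negate : ∀ a b t → + 2 * - a + t * - b ≡ - (+ 2 * a + t * b)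
    negate = solve-∀

  ⟦⟧-⊙ : ∀ n x → ⟦ n ⊙ x ⟧ ≡ n ⊙ ⟦ x ⟧
  ⟦⟧-⊙ n (a , b) = cong₂ _,_ (scale n a b t) (scale′ n b s)
    where
    scale : ∀ n a b t → + 2 * (n * a) + t * (n * b) ≡ n * (+ 2 * a + t * b)
    scale = solve-∀
    scale′ : ∀ n b s → s * (n * b) ≡ n * (s * b)
    scale′ = solve-∀

  ⟦fromℤ⟧ : ∀ n → ⟦ fromℤ n ⟧ ≡ (+ 2 * n , 0ℤ)
  ⟦fromℤ⟧ n = cong₂ _,_ (trans (cong (λ x → + 2 * n + x) (*-zeroʳ t)) (+-identityʳ (+ 2 * n))) (*-zeroʳ s)

  ⟦⟧-mul : ∀ x y → ⟦ mul D x y ⟧ ⊕ ⟦ mul D x y ⟧ ≡ ⟦ x ⟧ ⊛ ⟦ y ⟧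
  ⟦⟧-mul (a , b) (c , d) rewrite mul≡ a b c d = cong₂ _,_ first (second a b c d s t)
    where
    expand : ∀ a b c d t K → + 2 * (a * c + b * d * K) + t * (a * d + b * c + b * d * t)
                             + (+ 2 * (a * c + b * d * K) + t * (a * d + b * c + b * d * t))
                             ≡ (+ 2 * a + t * b) * (+ 2 * c + t * d) + b * d * (+ 4 * K + t * t)
    expand = solve-∀
    regroup : ∀ a b c d t s D → (+ 2 * a + t * b) * (+ 2 * c + t * d) + b * d * (s * s * D)
                                ≡ (+ 2 * a + t * b) * (+ 2 * c + t * d) + s * b * (s * d) * D
    regroup = solve-∀
    first = trans (expand a b c d t K) (trans (cong (λ x → (+ 2 * a + t * b) * (+ 2 * c + t * d) + b * d * x) 4K+t²≡s²D)
                                              (regroup a b c d t s (+ D)))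
    second : ∀ a b c d s t → s * (a * d + b * c + b * d * t) + s * (a * d + b * c + b * d * t)
                             ≡ (+ 2 * a + t * b) * (s * d) + s * b * (+ 2 * c + t * d)
    second = solve-∀

  -- Pos D x unfolds to a boolean test, from which x cannot be inferred; this wrapper can.
  record IsPositive (x : OK) : Set where
    constructor positive
    field surd-positive : Positive ⟦ x ⟧

  Pos⇒IsPositive : ∀ x → Pos D x → IsPositive x
  Pos⇒IsPositive x x>0 = positive (Pos⇒Positive x x>0)

  IsPositive⇒Pos : ∀ {x} → IsPositive x → Pos D x
  IsPositive⇒Pos {x} (positive ⟦x⟧>0) = Positive⇒Pos x ⟦x⟧>0

  IsNonNegative : OK → Set
  IsNonNegative x = IsPositive x ⊎ x ≡ fromℕ 0

  pos-≡ : ∀ {x y} → IsPositive x → x ≡ y → IsPositive y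
  pos-≡ x>0 refl = x>0

  ⊕-pos : ∀ {x y} → IsPositive x → IsPositive y → IsPositive (x ⊕ y)
  ⊕-pos {x} {y} (positive x>0) (positive y>0) = positive (Positive-≡ (Positive-+ x>0 y>0) (sym (⟦⟧-⊕ x y)))

  ⊙-pos : ∀ {n x} → 0ℤ < n → IsPositive x → IsPositive (n ⊙ x)
  ⊙-pos {n} {x} 0<n (positive x>0) = positive (Positive-≡ (Positive-⊙ 0<n x>0) (sym (⟦⟧-⊙ n x)))

  mul-pos : ∀ {x y} → IsPositive x → IsPositive y → IsPositive (mul D x y)
  mul-pos {x} {y} (positive x>0) (positive y>0) =
    positive (Positive-half (Positive-≡ (Positive-* x>0 y>0) (sym (⟦⟧-mul x y))))

  pos-asym : ∀ {x} → IsPositive x → ¬ IsPositive (⊝ x)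
  pos-asym {x} (positive x>0) (positive -x>0) = Positive-asym x>0 (Positive-≡ -x>0 (⟦⟧-⊝ x))

  ¬pos-0 : ¬ IsPositive (fromℕ 0)
  ¬pos-0 (positive 0>0) = ¬Positive-0 (Positive-≡ 0>0 (⟦fromℤ⟧ 0ℤ))

  fromℤ-pos : ∀ {n} → 0ℤ < n → IsPositive (fromℤ n)
  fromℤ-pos {n} 0<n = positive (Positive-≡ (nonNeg-pair (<⇒≤ 0<2n) (+≤+ z≤n) λ eq → <⇒≢ 0<2n (sym (cong proj₁ eq)))
                                           (sym (⟦fromℤ⟧ n)))
    where
    0<2n : 0ℤ < + 2 * n
    0<2n = *-pos {+ 2} (+<+ (s≤s z≤n)) 0<n

  fromℤ-pos⁻¹ : ∀ {n} → IsPositive (fromℤ n) → 0ℤ < n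
  fromℤ-pos⁻¹ {n} (positive n>0) with Positive-≡ n>0 (⟦fromℤ⟧ n)
  ... | rational-dominant 0<2n _ = 0<k*i⇒0<i {+ 2} (+≤+ z≤n) 0<2n
  ... | surd-dominant (+<+ ()) _

  pos-trichotomy : ∀ x → IsPositive x ⊎ IsPositive (⊝ x) ⊎ x ≡ fromℕ 0
  pos-trichotomy x with Positive-trichotomy ⟦ x ⟧
  ... | inj₁ ⟦x⟧>0        = inj₁ (positive ⟦x⟧>0)
  ... | inj₂ (inj₁ ⟦x⟧<0) = inj₂ (inj₁ (positive (Positive-≡ ⟦x⟧<0 (sym (⟦⟧-⊝ x)))))
  ... | inj₂ (inj₂ ⟦x⟧≡0) = inj₂ (inj₂ (⟦⟧≡0⇒≡0 x ⟦x⟧≡0))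
    where
    ⟦⟧≡0⇒≡0 : ∀ x → ⟦ x ⟧ ≡ (0ℤ , 0ℤ) → x ≡ fromℕ 0
    ⟦⟧≡0⇒≡0 (a , b) ⟦x⟧≡0 = cong₂ _,_ a≡0 b≡0
      where
      b≡0 : b ≡ 0ℤ
      b≡0 with i*j≡0⇒i≡0∨j≡0 s (cong proj₂ ⟦x⟧≡0)
      ... | inj₁ s≡0 = contradiction (sym s≡0) (<⇒≢ 0<s)
      ... | inj₂ b≡0 = b≡0
      2a≡0 : + 2 * a ≡ 0ℤ
      2a≡0 = begin
        + 2 * a           ≡⟨ sym (+-identityʳ (+ 2 * a)) ⟩
        + 2 * a + 0ℤ      ≡⟨ cong (λ x → + 2 * a + x) (sym (trans (cong (t *_) b≡0) (*-zeroʳ t))) ⟩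
        + 2 * a + t * b   ≡⟨ cong proj₁ ⟦x⟧≡0 ⟩
        0ℤ                ∎
        where open ≡-Reasoning
      a≡0 : a ≡ 0ℤ
      a≡0 with i*j≡0⇒i≡0∨j≡0 (+ 2) 2a≡0
      ... | inj₂ a≡0 = a≡0

  ⊕-pos-nonNeg : ∀ {x y} → IsPositive x → IsNonNegative y → IsPositive (x ⊕ y)
  ⊕-pos-nonNeg x>0 (inj₁ y>0)       = ⊕-pos x>0 y>0
  ⊕-pos-nonNeg {x} x>0 (inj₂ refl) = pos-≡ x>0 (sym (⊕-identityʳ x))

  ⊕-nonNeg-pos : ∀ {x y} → IsNonNegative x → IsPositive y → IsPositive (x ⊕ y)
  ⊕-nonNeg-pos {x} {y} x≥0 y>0 = pos-≡ (⊕-pos-nonNeg y>0 x≥0) (⊕-comm y x)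

  ⊕-nonNeg : ∀ {x y} → IsNonNegative x → IsNonNegative y → IsNonNegative (x ⊕ y)
  ⊕-nonNeg (inj₁ x>0)  y≥0         = inj₁ (⊕-pos-nonNeg x>0 y≥0)
  ⊕-nonNeg (inj₂ refl) (inj₁ y>0)  = inj₁ (⊕-nonNeg-pos (inj₂ refl) y>0)
  ⊕-nonNeg (inj₂ refl) (inj₂ refl) = inj₂ refl

  fromℤ-nonNeg : ∀ {n} → 0ℤ ≤ n → IsNonNegative (fromℤ n)
  fromℤ-nonNeg {+0}       _ = inj₂ refl
  fromℤ-nonNeg {+[1+ n ]} _ = inj₁ (fromℤ-pos (+<+ (s≤s z≤n)))

  ⊙-nonNeg : ∀ {n x} → 0ℤ ≤ n → IsPositive x → IsNonNegative (n ⊙ x)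
  ⊙-nonNeg {+0}       _ _   = inj₂ refl
  ⊙-nonNeg {+[1+ n ]} _ x>0 = inj₁ (⊙-pos {+[1+ n ]} (+<+ (s≤s z≤n)) x>0)

  ≤⇒nonNeg : ∀ x y → x ≤[ D ] y → IsNonNegative (y ⊖ x)
  ≤⇒nonNeg x y x≤y with pos-trichotomy (y ⊖ x)
  ... | inj₁ y-x>0        = inj₁ y-x>0
  ... | inj₂ (inj₁ x-y>0) = contradiction (IsPositive⇒Pos (pos-≡ x-y>0 (⊝-⊖ y x))) x≤y
  ... | inj₂ (inj₂ y-x≡0) = inj₂ y-x≡0

  conj-⊕ : ∀ x y → conj D (x ⊕ y) ≡ conj D x ⊕ conj D y
  conj-⊕ (a , b) (c , d) = begin
    conj D (a + c , b + d)                  ≡⟨ conj≡ (a + c) (b + d) ⟩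
    (a + c + t * (b + d) , - (b + d))        ≡⟨ cong₂ _,_ (regroup a b c d t) (neg-distrib-+ b d) ⟩
    (a + t * b , - b) ⊕ (c + t * d , - d)    ≡⟨ sym (cong₂ _⊕_ (conj≡ a b) (conj≡ c d)) ⟩
    conj D (a , b) ⊕ conj D (c , d)          ∎
    where
    open ≡-Reasoning
    regroup : ∀ a b c d t → a + c + t * (b + d) ≡ a + t * b + (c + t * d)
    regroup = solve-∀

  conj-⊝ : ∀ x → conj D (⊝ x) ≡ ⊝ conj D x
  conj-⊝ (a , b) = begin
    conj D (- a , - b)           ≡⟨ conj≡ (- a) (- b) ⟩
    (- a + t * - b , - - b)      ≡⟨ cong₂ _,_ (negate a b t) refl ⟩
    ⊝ (a + t * b , - b)          ≡⟨ cong ⊝_ (sym (conj≡ a b)) ⟩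
    ⊝ conj D (a , b)             ∎
    where
    open ≡-Reasoning
    negate : ∀ a b t → - a + t * - b ≡ - (a + t * b)
    negate = solve-∀

  mul-comm : ∀ x y → mul D x y ≡ mul D y x
  mul-comm (a , b) (c , d) = begin
    mul D (a , b) (c , d)                               ≡⟨ mul≡ a b c d ⟩
    (a * c + b * d * K , a * d + b * c + b * d * t)     ≡⟨ cong₂ _,_ (swap₁ a b c d K) (swap₂ a b c d t) ⟩
    (c * a + d * b * K , c * b + d * a + d * b * t)     ≡⟨ sym (mul≡ c d a b) ⟩
    mul D (c , d) (a , b)                               ∎
    where
    open ≡-Reasoning
    swap₁ : ∀ a b c d K → a * c + b * d * K ≡ c * a + d * b * K
    swap₁ = solve-∀
    swap₂ : ∀ a b c d t → a * d + b * c + b * d * t ≡ c * b + d * a + d * b * t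
    swap₂ = solve-∀

  mul-distribˡ-⊖ : ∀ x y z → mul D x (y ⊖ z) ≡ mul D x y ⊖ mul D x z
  mul-distribˡ-⊖ (a , b) (c , d) (e , f) = begin
    mul D (a , b) (c - e , d - f)                                 ≡⟨ mul≡ a b (c - e) (d - f) ⟩
    (a * (c - e) + b * (d - f) * K , a * (d - f) + b * (c - e) + b * (d - f) * t)
      ≡⟨ cong₂ _,_ (expand₁ a b c d e f K) (expand₂ a b c d e f t) ⟩
    (a * c + b * d * K , a * d + b * c + b * d * t) ⊖ (a * e + b * f * K , a * f + b * e + b * f * t)
      ≡⟨ sym (cong₂ _⊖_ (mul≡ a b c d) (mul≡ a b e f)) ⟩
    mul D (a , b) (c , d) ⊖ mul D (a , b) (e , f)                 ∎
    where
    open ≡-Reasoning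
    expand₁ : ∀ a b c d e f K → a * (c - e) + b * (d - f) * K ≡ a * c + b * d * K - (a * e + b * f * K)
    expand₁ = solve-∀
    expand₂ : ∀ a b c d e f t → a * (d - f) + b * (c - e) + b * (d - f) * t
                                ≡ a * d + b * c + b * d * t - (a * f + b * e + b * f * t)
    expand₂ = solve-∀

  mul-fromℤ : ∀ n x → mul D (fromℤ n) x ≡ n ⊙ x
  mul-fromℤ n (a , b) = trans (mul≡ n 0ℤ a b) (cong₂ _,_ (drop₁ n a b K) (drop₂ n a b t))
    where
    drop₁ : ∀ n a b K → n * a + 0ℤ * b * K ≡ n * a
    drop₁ = solve-∀
    drop₂ : ∀ n a b t → n * b + 0ℤ * a + 0ℤ * b * t ≡ n * b
    drop₂ = solve-∀

  ξ⊕ω≡ : ξ D ⊕ ω D ≡ (- t , + 2)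
  ξ⊕ω≡ = trans (cong (_⊕ ω D) ξ≡) (cong₂ _,_ (+-identityʳ (- t)) refl)

  -- x − x′ = b (ω − ω′) and ω − ω′ = ξ + ω.
  conj-split : ∀ x → x ≡ conj D x ⊕ proj₂ x ⊙ (ξ D ⊕ ω D)
  conj-split (a , b) = sym (begin
    conj D (a , b) ⊕ b ⊙ (ξ D ⊕ ω D)      ≡⟨ cong₂ (λ u v → u ⊕ b ⊙ v) (conj≡ a b) ξ⊕ω≡ ⟩
    (a + t * b , - b) ⊕ b ⊙ (- t , + 2)   ≡⟨ cong₂ _,_ (cancel₁ a b t) (cancel₂ b) ⟩
    (a , b)                               ∎)
    where
    open ≡-Reasoning
    cancel₁ : ∀ a b t → a + t * b + b * - t ≡ a
    cancel₁ = solve-∀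
    cancel₂ : ∀ b → - b + b * + 2 ≡ b
    cancel₂ = solve-∀

  ξ⊕ω-pos : IsPositive (ξ D ⊕ ω D)
  ξ⊕ω-pos = pos-≡ (positive (Positive-≡ (nonNeg-pair (+≤+ z≤n) (<⇒≤ 0<2s) λ eq → <⇒≢ 0<2s (sym (cong proj₂ eq)))
                                         (sym (√D-coordinates t s))))
                  (sym ξ⊕ω≡)
    where
    0<2s : 0ℤ < + 2 * s
    0<2s = *-pos {+ 2} (+<+ (s≤s z≤n)) 0<s
    √D-coordinates : ∀ t s → (+ 2 * - t + t * + 2 , s * + 2) ≡ (0ℤ , + 2 * s)
    √D-coordinates t s = cong₂ _,_ (solve (t ∷ [])) (solve (s ∷ []))

  -- Opaque: with-abstraction over these would otherwise unfold the whole positivity test.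
  opaque
    pos? : ∀ x → Dec (IsPositive x)
    pos? x = map′ (Pos⇒IsPositive x) IsPositive⇒Pos (T? (posPQ D (proj₁ (twice D x)) (proj₂ (twice D x))))

    nonNeg? : ∀ x → Dec (IsNonNegative x)
    nonNeg? x = pos? x ⊎-dec ≡-dec _≟_ _≟_ x (fromℕ 0)

  nonNeg⇒¬neg : ∀ {x} → IsNonNegative x → ¬ IsPositive (⊝ x)
  nonNeg⇒¬neg (inj₁ x>0)  = pos-asym x>0
  nonNeg⇒¬neg (inj₂ refl) = ¬pos-0

  ¬nonNeg⇒neg : ∀ {x} → ¬ IsNonNegative x → IsPositive (⊝ x)
  ¬nonNeg⇒neg {x} x≱0 with pos-trichotomy x
  ... | inj₁ x>0         = contradiction (inj₁ x>0) x≱0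
  ... | inj₂ (inj₁ -x>0) = -x>0
  ... | inj₂ (inj₂ x≡0)  = contradiction (inj₂ x≡0) x≱0

  ¬pos⇒nonNeg-neg : ∀ {x} → ¬ IsPositive x → IsNonNegative (⊝ x)
  ¬pos⇒nonNeg-neg {x} x≯0 with pos-trichotomy x
  ... | inj₁ x>0         = contradiction x>0 x≯0
  ... | inj₂ (inj₁ -x>0) = inj₁ -x>0
  ... | inj₂ (inj₂ refl) = inj₂ refl

  pair-pos : ∀ {a b} → 0ℤ < a → 0ℤ ≤ b → IsPositive (a , b)
  pair-pos {a} {b} 0<a 0≤b =
    positive (nonNeg-pair (<⇒≤ 0<2a+tb) (*-nonNeg (<⇒≤ 0<s) 0≤b) λ eq → <⇒≢ 0<2a+tb (sym (cong proj₁ eq)))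
    where
    0<2a+tb : 0ℤ < + 2 * a + t * b
    0<2a+tb = +-mono-<-≤ (*-pos {+ 2} (+<+ (s≤s z≤n)) 0<a) (*-nonNeg 0≤t 0≤b)

  archimedean : ∀ {x} → IsPositive x → 0ℤ ≤ proj₂ x → Σ ℕ λ n → IsPositive ((+ n) ⊙ x ⊖ fromℕ 1)
  archimedean {a , b} (positive x>0) 0≤b with Positive-archimedean x>0 (*-nonNeg (<⇒≤ 0<s) 0≤b)
  ... | n , n⟦x⟧>2 = n , positive (Positive-≡ n⟦x⟧>2 (sym (begin
    ⟦ (+ n) ⊙ (a , b) ⊖ fromℕ 1 ⟧               ≡⟨ ⟦⟧-⊕ ((+ n) ⊙ (a , b)) (⊝ fromℕ 1) ⟩
    ⟦ (+ n) ⊙ (a , b) ⟧ ⊕ ⟦ ⊝ fromℕ 1 ⟧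
      ≡⟨ cong₂ _⊕_ (⟦⟧-⊙ (+ n) (a , b)) (trans (⟦⟧-⊝ (fromℕ 1)) (cong ⊝_ (⟦fromℤ⟧ (+ 1)))) ⟩
    (+ n) ⊙ ⟦ a , b ⟧ ⊖ (+ 2 , 0ℤ)              ∎)))
    where open ≡-Reasoning

module Ceilings (D : ℕ) (irrational : IrrationalSqrt (+ D)) where
  open import Data.Integer using (_+_; _*_; -_; _-_; _≤_; _<_; +≤+)
  open import Data.Integer.Properties using (i≤j⇒0≤j-i; drop‿+≤+; ≤-antisym; +-identityʳ; +-identityˡ)
  open import Data.Integer.Tactic.RingSolver using (solve-∀)
  open import Data.Sum using (inj₁; inj₂)
  open import Relation.Nullary using (¬_; contradiction)
  open import Relation.Binary.PropositionalEquality using (sym; trans; cong; cong₂; subst; module ≡-Reasoning)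
  open IntegerInequalities
  open RealEmbedding D irrational

  -- c − y ξ, which lies in [0, 1) exactly when c = ⌈ y ξ ⌉
  gap : ℤ → ℕ → OK
  gap c y = fromℤ c ⊖ mul D (fromℕ y) (ξ D)

  gap≡ : ∀ c y → gap c y ≡ (c + + y * t , - + y)
  gap≡ c y = begin
    fromℤ c ⊖ mul D (fromℕ y) (ξ D)   ≡⟨ cong (λ v → fromℤ c ⊖ v) (trans (mul-fromℤ (+ y) (ξ D)) (cong ((+ y) ⊙_) ξ≡)) ⟩
    fromℤ c ⊖ (+ y) ⊙ (- t , + 1)     ≡⟨ cong₂ _,_ (simplify₁ c (+ y) t) (simplify₂ (+ y)) ⟩
    (c + + y * t , - + y)             ∎
    where
    open ≡-Reasoning
    simplify₁ : ∀ c y t → c + - (y * - t) ≡ c + y * t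
    simplify₁ = solve-∀
    simplify₂ : ∀ y → 0ℤ + - (y * + 1) ≡ - y
    simplify₂ = solve-∀

  UnitInterval : OK → Set
  UnitInterval g = IsNonNegative g × IsPositive (fromℕ 1 ⊖ g)

  isCeil⇒unitInterval : ∀ c y → IsCeil D c (mul D (fromℕ y) (ξ D)) → UnitInterval (gap c y)
  isCeil⇒unitInterval c y (yξ≤c , c<yξ+1) =
    ≤⇒nonNeg (mul D (fromℕ y) (ξ D)) (fromℤ c) yξ≤c , pos-≡ (Pos⇒IsPositive _ c<yξ+1) (shift (mul D (fromℕ y) (ξ D)) c)
    where
    shift : ∀ x c → (x ⊕ fromℕ 1) ⊖ fromℤ c ≡ fromℕ 1 ⊖ (fromℤ c ⊖ x)
    shift (a , b) c = cong₂ _,_ (shift₁ a c) (shift₂ b)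
      where
      shift₁ : ∀ a c → a + + 1 + - c ≡ + 1 + - (c + - a)
      shift₁ = solve-∀
      shift₂ : ∀ b → b + 0ℤ + - 0ℤ ≡ 0ℤ + - (0ℤ + - b)
      shift₂ = solve-∀

  integer-part-mono : ∀ {g₁ g₂ m₁ m₂} → UnitInterval g₁ → UnitInterval g₂ →
                      IsNonNegative ((g₂ ⊕ fromℤ m₂) ⊖ (g₁ ⊕ fromℤ m₁)) → m₁ ≤ m₂
  integer-part-mono {g₁} {g₂} {m₁} {m₂} (g₁≥0 , _) (_ , 1-g₂>0) diff≥0 =
    0<1+j-i⇒i≤j (fromℤ-pos⁻¹ (pos-≡ (⊕-nonNeg-pos diff≥0 (⊕-pos-nonNeg 1-g₂>0 g₁≥0)) (telescope g₁ g₂ m₁ m₂)))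
    where
    telescope : ∀ g₁ g₂ m₁ m₂ → ((g₂ ⊕ fromℤ m₂) ⊖ (g₁ ⊕ fromℤ m₁)) ⊕ ((fromℕ 1 ⊖ g₂) ⊕ g₁) ≡ fromℤ (+ 1 + m₂ - m₁)
    telescope (a , b) (c , d) m₁ m₂ = cong₂ _,_ (telescope₁ a c m₁ m₂) (telescope₂ b d)
      where
      telescope₁ : ∀ a c m₁ m₂ → c + m₂ + - (a + m₁) + (+ 1 + - c + a) ≡ + 1 + m₂ - m₁
      telescope₁ = solve-∀
      telescope₂ : ∀ b d → d + 0ℤ + - (b + 0ℤ) + (0ℤ + - d + b) ≡ 0ℤ
      telescope₂ = solve-∀

  ceiling-unique : ∀ {c₁ c₂ y} → UnitInterval (gap c₁ y) → UnitInterval (gap c₂ y) → c₁ ≡ c₂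
  ceiling-unique {c₁} {c₂} {y} g₁∈ g₂∈ =
    ≤-antisym (integer-part-mono g₂∈ g₁∈ (shifted-gaps c₂ c₁)) (integer-part-mono g₁∈ g₂∈ (shifted-gaps c₁ c₂))
    where
    shifted-gaps : ∀ c c′ → IsNonNegative ((gap c′ y ⊕ fromℤ c) ⊖ (gap c y ⊕ fromℤ c′))
    shifted-gaps c c′ = inj₂ (begin
      (gap c′ y ⊕ fromℤ c) ⊖ (gap c y ⊕ fromℤ c′)
        ≡⟨ cong₂ (λ u v → (u ⊕ fromℤ c) ⊖ (v ⊕ fromℤ c′)) (gap≡ c′ y) (gap≡ c y) ⟩
      ((c′ + + y * t , - + y) ⊕ fromℤ c) ⊖ ((c + + y * t , - + y) ⊕ fromℤ c′)
        ≡⟨ cong₂ _,_ (cancel₁ c c′ (+ y * t)) (cancel₂ (- + y)) ⟩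
      fromℕ 0 ∎)
      where
      open ≡-Reasoning
      cancel₁ : ∀ c c′ u → c′ + u + c + - (c + u + c′) ≡ 0ℤ
      cancel₁ = solve-∀
      cancel₂ : ∀ v → v + 0ℤ + - (v + 0ℤ) ≡ 0ℤ
      cancel₂ = solve-∀

  conj-mkα : ∀ c k y → conj D (mkα c k y) ≡ gap c y ⊕ fromℕ k
  conj-mkα c k y = begin
    conj D (c + + k , + y)             ≡⟨ conj≡ (c + + k) (+ y) ⟩
    (c + + k + t * + y , - + y)        ≡⟨ cong₂ _,_ (regroup c (+ k) (+ y) t) (sym (+-identityʳ (- + y))) ⟩
    (c + + y * t , - + y) ⊕ fromℕ k    ≡⟨ cong (_⊕ fromℕ k) (sym (gap≡ c y)) ⟩
    gap c y ⊕ fromℕ k                  ∎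
    where
    open ≡-Reasoning
    regroup : ∀ c k y t → c + k + t * y ≡ c + y * t + k
    regroup = solve-∀

  conj-mkα-⊖ : ∀ c₁ k₁ y₁ c₂ k₂ y₂ →
               conj D (mkα c₂ k₂ y₂ ⊖ mkα c₁ k₁ y₁) ≡ (gap c₂ y₂ ⊕ fromℕ k₂) ⊖ (gap c₁ y₁ ⊕ fromℕ k₁)
  conj-mkα-⊖ c₁ k₁ y₁ c₂ k₂ y₂ = begin
    conj D (mkα c₂ k₂ y₂ ⊖ mkα c₁ k₁ y₁)              ≡⟨ conj-⊕ (mkα c₂ k₂ y₂) (⊝ mkα c₁ k₁ y₁) ⟩
    conj D (mkα c₂ k₂ y₂) ⊕ conj D (⊝ mkα c₁ k₁ y₁)   ≡⟨ cong (conj D (mkα c₂ k₂ y₂) ⊕_) (conj-⊝ (mkα c₁ k₁ y₁)) ⟩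
    conj D (mkα c₂ k₂ y₂) ⊖ conj D (mkα c₁ k₁ y₁)     ≡⟨ cong₂ _⊖_ (conj-mkα c₂ k₂ y₂) (conj-mkα c₁ k₁ y₁) ⟩
    (gap c₂ y₂ ⊕ fromℕ k₂) ⊖ (gap c₁ y₁ ⊕ fromℕ k₁)   ∎
    where open ≡-Reasoning

  conj-pos⇒totPos : ∀ x → 0ℤ ≤ proj₂ x → IsPositive (conj D x) → TotPos D x
  conj-pos⇒totPos x 0≤b x′>0 =
    IsPositive⇒Pos (pos-≡ (⊕-pos-nonNeg x′>0 (⊙-nonNeg 0≤b ξ⊕ω-pos)) (sym (conj-split x))) , IsPositive⇒Pos x′>0

  conj-⊖-self : ∀ x → conj D (x ⊖ x) ≡ fromℕ 0
  conj-⊖-self x = trans (conj-⊕ x (⊝ x)) (trans (cong (conj D x ⊕_) (conj-⊝ x)) (⊖-self (conj D x)))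

  lemma5p3-ii : (ε : OK) → IsEpsPlus D ε → (y k : ℕ) (c : ℤ) → IsCeil D c (mul D (fromℕ y) (ξ D)) →
                QuotLe D (mkα c k y) (conj D (mkα c k y)) ε →
                mul D (fromℕ y) (ξ D ⊕ ω D) <[ D ] (mul D (fromℕ (suc k)) ε ⊖ fromℕ k)
  lemma5p3-ii ε ((ε>0 , _) , _) y k c ceil (inj₂ (α′<0 , _)) =
    contradiction (pos-≡ (Pos⇒IsPositive _ α′<0) (+-identityˡ-⊖ α′))
                  (nonNeg⇒¬neg (subst IsNonNegative (sym (conj-mkα c k y)) (⊕-nonNeg g≥0 (fromℤ-nonNeg (+-nonNeg k)))))
    where
    α′ : OK
    α′ = conj D (mkα c k y)
    g≥0 : IsNonNegative (gap c y)
    g≥0 = proj₁ (isCeil⇒unitInterval c y ceil)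
    +-identityˡ-⊖ : ∀ x → fromℕ 0 ⊖ x ≡ ⊝ x
    +-identityˡ-⊖ (a , b) = cong₂ _,_ (+-identityˡ (- a)) (+-identityˡ (- b))
  lemma5p3-ii ε ((ε>0 , _) , _) y k c ceil (inj₁ (_ , α≤εα′)) =
    IsPositive⇒Pos (pos-≡ (⊕-pos-nonNeg (⊕-nonNeg-pos (≤⇒nonNeg α (mul D ε α′) α≤εα′)
                                                     (mul-pos (Pos⇒IsPositive ε ε>0) 1-g>0))
                                       g≥0)
                          identity)
    where
    α α′ g : OK
    α  = mkα c k y
    α′ = conj D α
    g  = gap c y
    g≥0 : IsNonNegative g
    g≥0 = proj₁ (isCeil⇒unitInterval c y ceil)
    1-g>0 : IsPositive (fromℕ 1 ⊖ g)
    1-g>0 = proj₂ (isCeil⇒unitInterval c y ceil)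
    α≡ : α ≡ (g ⊕ fromℕ k) ⊕ (+ y) ⊙ (ξ D ⊕ ω D)
    α≡ = trans (conj-split α) (cong (_⊕ (+ y) ⊙ (ξ D ⊕ ω D)) (conj-mkα c k y))
    one-minus : ∀ g k → fromℕ 1 ⊖ g ≡ fromℤ (+ 1 + k) ⊖ (g ⊕ fromℤ k)
    one-minus (a , b) k = cong₂ _,_ (first a k) (second b)
      where
      first : ∀ a k → + 1 + - a ≡ + 1 + k + - (a + k)
      first = solve-∀
      second : ∀ b → 0ℤ + - b ≡ 0ℤ + - (b + 0ℤ)
      second = solve-∀
    collapse : ∀ P Q g K Y → ((P ⊖ ((g ⊕ K) ⊕ Y)) ⊕ (Q ⊖ P)) ⊕ g ≡ (Q ⊖ K) ⊖ Y
    collapse (p , p′) (q , q′) (a , a′) (k , k′) (u , u′) = cong₂ _,_ (telescope p q a k u) (telescope p′ q′ a′ k′ u′)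
      where
      telescope : ∀ p q a k u → p + - (a + k + u) + (q + - p) + a ≡ q + - k + - u
      telescope = solve-∀
    identity : ((mul D ε α′ ⊖ α) ⊕ mul D ε (fromℕ 1 ⊖ g)) ⊕ g
               ≡ (mul D (fromℕ (suc k)) ε ⊖ fromℕ k) ⊖ mul D (fromℕ y) (ξ D ⊕ ω D)
    identity = begin
      ((mul D ε α′ ⊖ α) ⊕ mul D ε (fromℕ 1 ⊖ g)) ⊕ g
        ≡⟨ cong (λ v → ((mul D ε α′ ⊖ α) ⊕ mul D ε v) ⊕ g)
                (trans (one-minus g (+ k)) (cong (fromℕ (suc k) ⊖_) (sym (conj-mkα c k y)))) ⟩
      ((mul D ε α′ ⊖ α) ⊕ mul D ε (fromℕ (suc k) ⊖ α′)) ⊕ g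
        ≡⟨ cong (λ v → ((mul D ε α′ ⊖ α) ⊕ v) ⊕ g) (mul-distribˡ-⊖ ε (fromℕ (suc k)) α′) ⟩
      ((mul D ε α′ ⊖ α) ⊕ (mul D ε (fromℕ (suc k)) ⊖ mul D ε α′)) ⊕ g
        ≡⟨ cong (λ a → ((mul D ε α′ ⊖ a) ⊕ (mul D ε (fromℕ (suc k)) ⊖ mul D ε α′)) ⊕ g) α≡ ⟩
      ((mul D ε α′ ⊖ ((g ⊕ fromℕ k) ⊕ (+ y) ⊙ (ξ D ⊕ ω D))) ⊕ (mul D ε (fromℕ (suc k)) ⊖ mul D ε α′)) ⊕ g
        ≡⟨ collapse (mul D ε α′) (mul D ε (fromℕ (suc k))) g (fromℕ k) ((+ y) ⊙ (ξ D ⊕ ω D)) ⟩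
      (mul D ε (fromℕ (suc k)) ⊖ fromℕ k) ⊖ (+ y) ⊙ (ξ D ⊕ ω D)
        ≡⟨ cong₂ (λ u v → (u ⊖ fromℕ k) ⊖ v) (mul-comm ε (fromℕ (suc k))) (sym (mul-fromℤ (+ y) (ξ D ⊕ ω D))) ⟩
      (mul D (fromℕ (suc k)) ε ⊖ fromℕ k) ⊖ mul D (fromℕ y) (ξ D ⊕ ω D)
        ∎
      where open ≡-Reasoning

  lemma5p3-iii : (k₁ y₁ k₂ y₂ : ℕ) (c₁ c₂ : ℤ) →
                 IsCeil D c₁ (mul D (fromℕ y₁) (ξ D)) → IsCeil D c₂ (mul D (fromℕ y₂) (ξ D)) →
                 y₁ ℕ.≤ y₂ → k₁ ℕ.< k₂ → mkα c₁ k₁ y₁ ≺[ D ] mkα c₂ k₂ y₂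
  lemma5p3-iii k₁ y₁ k₂ y₂ c₁ c₂ ceil₁ ceil₂ y₁≤y₂ k₁<k₂ =
    conj-pos⇒totPos (mkα c₂ k₂ y₂ ⊖ mkα c₁ k₁ y₁) (i≤j⇒0≤j-i (+≤+ y₁≤y₂))
      (pos-≡ (⊕-nonNeg-pos g₂≥0 (⊕-pos-nonNeg 1-g₁>0 (fromℤ-nonNeg (i≤j⇒0≤j-i (+≤+ k₁<k₂)))))
             (trans (regroup (gap c₁ y₁) (gap c₂ y₂) (+ k₁) (+ k₂)) (sym (conj-mkα-⊖ c₁ k₁ y₁ c₂ k₂ y₂))))
    where
    g₂≥0 : IsNonNegative (gap c₂ y₂)
    g₂≥0 = proj₁ (isCeil⇒unitInterval c₂ y₂ ceil₂)
    1-g₁>0 : IsPositive (fromℕ 1 ⊖ gap c₁ y₁)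
    1-g₁>0 = proj₂ (isCeil⇒unitInterval c₁ y₁ ceil₁)
    regroup : ∀ g₁ g₂ k₁ k₂ → g₂ ⊕ ((fromℕ 1 ⊖ g₁) ⊕ fromℤ (k₂ - (+ 1 + k₁))) ≡ (g₂ ⊕ fromℤ k₂) ⊖ (g₁ ⊕ fromℤ k₁)
    regroup (a , b) (c , d) k₁ k₂ = cong₂ _,_ (first a c k₁ k₂) (second b d)
      where
      first : ∀ a c k₁ k₂ → c + (+ 1 + - a + (k₂ - (+ 1 + k₁))) ≡ c + k₂ + - (a + k₁)
      first = solve-∀
      second : ∀ b d → d + (0ℤ + - b + 0ℤ) ≡ d + 0ℤ + - (b + 0ℤ)
      second = solve-∀

  lemma5p3-iv : (k₁ y₁ k₂ y₂ : ℕ) (c₁ c₂ : ℤ) →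
                IsCeil D c₁ (mul D (fromℕ y₁) (ξ D)) → IsCeil D c₂ (mul D (fromℕ y₂) (ξ D)) →
                mkα c₁ k₁ y₁ ⪯[ D ] mkα c₂ k₂ y₂ → k₁ ℕ.≤ k₂
  lemma5p3-iv k₁ y₁ k₂ y₂ c₁ c₂ ceil₁ ceil₂ α₁⪯α₂ = drop‿+≤+
    (integer-part-mono (isCeil⇒unitInterval c₁ y₁ ceil₁) (isCeil⇒unitInterval c₂ y₂ ceil₂)
      (subst IsNonNegative (conj-mkα-⊖ c₁ k₁ y₁ c₂ k₂ y₂) (conj-nonNeg α₁⪯α₂)))
    where
    conj-nonNeg : mkα c₁ k₁ y₁ ⪯[ D ] mkα c₂ k₂ y₂ → IsNonNegative (conj D (mkα c₂ k₂ y₂ ⊖ mkα c₁ k₁ y₁))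
    conj-nonNeg (inj₁ (_ , α₂′-α₁′>0)) = inj₁ (Pos⇒IsPositive _ α₂′-α₁′>0)
    conj-nonNeg (inj₂ α₁≡α₂) =
      inj₂ (trans (cong (λ a → conj D (a ⊖ mkα c₁ k₁ y₁)) (sym α₁≡α₂)) (conj-⊖-self (mkα c₁ k₁ y₁)))

crossing : ∀ {P : ℕ → Set} → (∀ n → Dec (P n)) → ¬ P 0 → ∀ n → P n → Σ ℕ λ m → ¬ P m × P (suc m)
crossing P? ¬P0 ℕ.zero P0 = contradiction P0 ¬P0
crossing P? ¬P0 (suc n) Psn with P? n
... | yes Pn = crossing P? ¬P0 n Pn
... | no ¬Pn = n , ¬Pn , Psn

module Density (D : ℕ) (irrational : IrrationalSqrt (+ D)) where
  open import Data.Nat using (zero; z≤n; s≤s)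
  open import Data.Fin as Fin using (Fin; toℕ)
  open import Data.Fin.Properties using (toℕ<n; toℕ-injective)
  open import Data.List using (List; []; _∷_)
  import Data.List.Relation.Unary.All as All
  open import Data.List.Relation.Unary.Any using (here; there)
  open import Data.List.Relation.Binary.Permutation.Propositional using (_↭_; ↭-sym)
  open import Data.List.Membership.Propositional using (_∈_)
  open import Data.List.Relation.Binary.Permutation.Propositional.Properties using (∈-resp-↭; ↭-length)
  import Data.Nat.Properties as ℕP
  open import Data.Integer using (_+_; _*_; -_; _-_; _≤_; _<_; +≤+; +<+; -[1+_]; ∣_∣)
  open import Data.Integer.Properties using (+-mono-≤; +-mono-≤-<; +-mono-<-≤; <⇒≤; 0≤i⇒+∣i∣≡i; neg-involutive
      ; i≤j⇒0≤j-i; +-injective; +-identityˡ; +-identityʳ; pos-+; neg-distrib-+)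
  open import Data.Integer.Tactic.RingSolver using (solve-∀; solve)
  open import Data.Sum using (_⊎_; inj₁; inj₂; [_,_]′)
  open import Data.Empty using (⊥-elim)
  open import Function using (id)
  open import Relation.Binary.PropositionalEquality using (refl; sym; trans; cong; cong₂; subst; module ≡-Reasoning)
  open IntegerInequalities
  open RealEmbedding D irrational
  open Ceilings D irrational

  -- An integer bound for ξ, so that ⌈y ξ⌉ ≤ y s (D + 1).
  ξ<s[D+1] : IsPositive (fromℤ (s * (+ D + + 1)) ⊖ ξ D)
  ξ<s[D+1] = pos-≡ (positive (Positive-≡ (rational-dominant 0<first 0<norm) (sym (coordinates s t (+ D)))))
                   (cong (fromℤ (s * (+ D + + 1)) ⊖_) (sym ξ≡))
    where
    coordinates : ∀ s t d → (+ 2 * (s * (d + + 1) + - - t) + t * (0ℤ + - + 1) , s * (0ℤ + - + 1))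
                            ≡ (+ 2 * (s * (d + + 1)) + t , - s)
    coordinates s t d = cong₂ _,_ (solve (s ∷ t ∷ d ∷ [])) (solve (s ∷ []))
    0≤D : 0ℤ ≤ + D
    0≤D = +-nonNeg D
    0<D+1 : 0ℤ < + D + + 1
    0<D+1 = +-mono-≤-< 0≤D (+<+ (s≤s z≤n))
    0<first : 0ℤ < + 2 * (s * (+ D + + 1)) + t
    0<first = +-mono-<-≤ (*-pos {+ 2} (+<+ (s≤s z≤n)) (*-pos 0<s 0<D+1)) 0≤t
    0<4D²+7D+4 : 0ℤ < + 4 * + D * + D + + 7 * + D + + 4
    0<4D²+7D+4 = +-mono-≤-< (+-mono-≤ (*-nonNeg (*-nonNeg (+-nonNeg 4) 0≤D) 0≤D) (*-nonNeg (+-nonNeg 7) 0≤D)) (+<+ (s≤s z≤n))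
    0<norm : 0ℤ < (+ 2 * (s * (+ D + + 1)) + t) * (+ 2 * (s * (+ D + + 1)) + t) - (- s) * (- s) * + D
    0<norm = 0<-≡ (+-mono-<-≤ (*-pos (*-pos 0<s 0<s) 0<4D²+7D+4)
                              (+-mono-≤ (*-nonNeg (*-nonNeg (*-nonNeg (+-nonNeg 4) (<⇒≤ 0<s)) 0≤t) (<⇒≤ 0<D+1))
                                        (square-nonNeg t)))
                  (expand s t (+ D))
      where
      expand : ∀ s t d → s * s * (+ 4 * d * d + + 7 * d + + 4) + (+ 4 * s * t * (d + + 1) + t * t)
                         ≡ (+ 2 * (s * (d + + 1)) + t) * (+ 2 * (s * (d + + 1)) + t) - (- s) * (- s) * d
      expand = solve-∀

  private
    0≤D+1 : 0ℤ ≤ + D + + 1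
    0≤D+1 = +-nonNeg (D ℕ.+ 1)

    lo hi : ℕ → ℤ
    lo y = -[1+ 0 ] - + y * t
    hi y = + y * (s * (+ D + + 1))

    gap[lo]≱0 : ∀ y → ¬ IsNonNegative (gap (lo y + + 0) y)
    gap[lo]≱0 y gap≥0 = nonNeg⇒¬neg gap≥0 (pos-≡ (pair-pos {+ 1} {+ y} (+<+ (s≤s z≤n)) (+≤+ z≤n)) (sym negated))
      where
      negated : ⊝ gap (lo y + + 0) y ≡ (+ 1 , + y)
      negated = begin
        ⊝ gap (lo y + + 0) y                               ≡⟨ cong ⊝_ (gap≡ (lo y + + 0) y) ⟩
        ⊝ (-[1+ 0 ] - + y * t + + 0 + + y * t , - + y)     ≡⟨ cong₂ _,_ (cancel (+ y * t)) (neg-involutive (+ y)) ⟩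
        (+ 1 , + y)                                        ∎
        where
        open ≡-Reasoning
        cancel : ∀ u → - (-[1+ 0 ] - u + + 0 + u) ≡ + 1
        cancel = solve-∀

    gap[hi]≥0 : ∀ y → IsNonNegative (gap (lo y + + ∣ hi y - lo y ∣) y)
    gap[hi]≥0 y = subst (λ c → IsNonNegative (gap c y)) (sym lo+∣hi-lo∣≡hi)
                    (subst IsNonNegative (sym gap[hi]≡) (⊙-nonNeg (+-nonNeg y) ξ<s[D+1]))
      where
      0≤hi-lo : 0ℤ ≤ hi y - lo y
      0≤hi-lo = 0≤-≡ (+-mono-≤ (*-nonNeg (+-nonNeg y) (*-nonNeg (<⇒≤ 0<s) 0≤D+1))
                               (+-mono-≤ (+-nonNeg 1) (*-nonNeg (+-nonNeg y) 0≤t)))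
                     (difference (+ y) (s * (+ D + + 1)) t)
        where
        difference : ∀ y u t → y * u + (+ 1 + y * t) ≡ y * u - (-[1+ 0 ] - y * t)
        difference = solve-∀
      lo+∣hi-lo∣≡hi : lo y + + ∣ hi y - lo y ∣ ≡ hi y
      lo+∣hi-lo∣≡hi = trans (cong (λ n → lo y + n) (0≤i⇒+∣i∣≡i 0≤hi-lo)) (cancel (lo y) (hi y))
        where
        cancel : ∀ l h → l + (h - l) ≡ h
        cancel = solve-∀
      gap[hi]≡ : gap (hi y) y ≡ (+ y) ⊙ (fromℤ (s * (+ D + + 1)) ⊖ ξ D)
      gap[hi]≡ = begin
        gap (hi y) y                                             ≡⟨ gap≡ (hi y) y ⟩
        (+ y * (s * (+ D + + 1)) + + y * t , - + y)
          ≡⟨ cong₂ _,_ (distribute (+ y) (s * (+ D + + 1)) t) (negate (+ y)) ⟩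
        (+ y) ⊙ (fromℤ (s * (+ D + + 1)) ⊖ (- t , + 1))
          ≡⟨ cong (λ v → (+ y) ⊙ (fromℤ (s * (+ D + + 1)) ⊖ v)) (sym ξ≡) ⟩
        (+ y) ⊙ (fromℤ (s * (+ D + + 1)) ⊖ ξ D)                   ∎
        where
        open ≡-Reasoning
        distribute : ∀ y u t → y * u + y * t ≡ y * (u + - - t)
        distribute = solve-∀
        negate : ∀ y → - y ≡ y * (0ℤ + - + 1)
        negate = solve-∀

    gap-shift : ∀ c n y → ⊝ gap (c + + n) y ≡ fromℕ 1 ⊖ gap (c + + suc n) y
    gap-shift c n y = begin
      ⊝ gap (c + + n) y                                  ≡⟨ cong ⊝_ (gap≡ (c + + n) y) ⟩
      ⊝ (c + + n + + y * t , - + y)                      ≡⟨ cong₂ _,_ (shift c (+ n) (+ y * t)) (sym (+-identityˡ (- - + y))) ⟩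
      fromℕ 1 ⊖ (c + + suc n + + y * t , - + y)          ≡⟨ cong (fromℕ 1 ⊖_) (sym (gap≡ (c + + suc n) y)) ⟩
      fromℕ 1 ⊖ gap (c + + suc n) y                      ∎
      where
      open ≡-Reasoning
      shift : ∀ c n u → - (c + n + u) ≡ + 1 + - (c + (+ 1 + n) + u)
      shift = solve-∀

  ceiling : ∀ y → Σ ℤ λ c → UnitInterval (gap c y)
  ceiling y with crossing (λ n → nonNeg? (gap (lo y + + n) y)) (gap[lo]≱0 y) ∣ hi y - lo y ∣ (gap[hi]≥0 y)
  ... | n , gap[c-1]≱0 , gap[c]≥0 = lo y + + suc n , gap[c]≥0 , pos-≡ (¬nonNeg⇒neg gap[c-1]≱0) (gap-shift (lo y) n y)

  -- Opaque, so that with-abstraction does not unfold the search behind the ceiling.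
  opaque
    ⌈_ξ⌉ : ℕ → ℤ
    ⌈ y ξ⌉ = proj₁ (ceiling y)

    ceiling∈ : ∀ y → UnitInterval (gap ⌈ y ξ⌉ y)
    ceiling∈ y = proj₂ (ceiling y)

  defect : ℕ → OK
  defect y = gap ⌈ y ξ⌉ y

  defect∈ : ∀ y → UnitInterval (defect y)
  defect∈ = ceiling∈

  defect-≡ : ∀ c y → UnitInterval (gap c y) → defect y ≡ gap c y
  defect-≡ c y gap∈ = cong (λ c → gap c y) (ceiling-unique {⌈ y ξ⌉} {c} {y} (defect∈ y) gap∈)

  -- y ξ is irrational for y ≥ 1, so it is never an integer.
  gap-pos : ∀ c y → 1 ℕ.≤ y → UnitInterval (gap c y) → IsPositive (gap c y)
  gap-pos _ _ _ (inj₁ gap>0 , _) = gap>0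
  gap-pos c (suc y) _ (inj₂ gap≡0 , _) with trans (sym (cong proj₂ (gap≡ c (suc y)))) (cong proj₂ gap≡0)
  ... | ()

  gap-+ : ∀ c₁ c₂ y₁ y₂ → gap (c₁ + c₂) (y₁ ℕ.+ y₂) ≡ gap c₁ y₁ ⊕ gap c₂ y₂
  gap-+ c₁ c₂ y₁ y₂ = begin
    gap (c₁ + c₂) (y₁ ℕ.+ y₂)                              ≡⟨ gap≡ (c₁ + c₂) (y₁ ℕ.+ y₂) ⟩
    (c₁ + c₂ + + (y₁ ℕ.+ y₂) * t , - + (y₁ ℕ.+ y₂))         ≡⟨ cong (λ y → (c₁ + c₂ + y * t , - y)) (pos-+ y₁ y₂) ⟩
    (c₁ + c₂ + (+ y₁ + + y₂) * t , - (+ y₁ + + y₂))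
      ≡⟨ cong₂ _,_ (regroup c₁ c₂ (+ y₁) (+ y₂) t) (neg-distrib-+ (+ y₁) (+ y₂)) ⟩
    (c₁ + + y₁ * t , - + y₁) ⊕ (c₂ + + y₂ * t , - + y₂)     ≡⟨ sym (cong₂ _⊕_ (gap≡ c₁ y₁) (gap≡ c₂ y₂)) ⟩
    gap c₁ y₁ ⊕ gap c₂ y₂                                  ∎
    where
    open ≡-Reasoning
    regroup : ∀ c₁ c₂ y₁ y₂ t → c₁ + c₂ + (y₁ + y₂) * t ≡ c₁ + y₁ * t + (c₂ + y₂ * t)
    regroup = solve-∀

  gap-pred : ∀ c y → gap (c - + 1) y ≡ gap c y ⊖ fromℕ 1
  gap-pred c y = begin
    gap (c - + 1) y                         ≡⟨ gap≡ (c - + 1) y ⟩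
    (c - + 1 + + y * t , - + y)             ≡⟨ cong₂ _,_ (regroup c (+ y * t)) (sym (+-identityʳ (- + y))) ⟩
    (c + + y * t , - + y) ⊖ fromℕ 1         ≡⟨ cong (_⊖ fromℕ 1) (sym (gap≡ c y)) ⟩
    gap c y ⊖ fromℕ 1                       ∎
    where
    open ≡-Reasoning
    regroup : ∀ c u → c - + 1 + u ≡ c + u - + 1
    regroup = solve-∀

  gap-sum-1 : ∀ j z → gap (⌈ j ξ⌉ + ⌈ z ξ⌉ - + 1) (j ℕ.+ z) ≡ (defect j ⊕ defect z) ⊖ fromℕ 1
  gap-sum-1 j z = trans (gap-pred (⌈ j ξ⌉ + ⌈ z ξ⌉) (j ℕ.+ z)) (cong (_⊖ fromℕ 1) (gap-+ ⌈ j ξ⌉ ⌈ z ξ⌉ j z))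

  -- ⌈ (j + z) ξ ⌉ is ⌈ j ξ ⌉ + ⌈ z ξ ⌉ or one less; in the first case the defect grows.
  defect-step : ∀ j z → 1 ℕ.≤ j → ¬ IsPositive (defect (j ℕ.+ z) ⊖ defect z) →
                defect (j ℕ.+ z) ≡ (defect j ⊕ defect z) ⊖ fromℕ 1
  defect-step j z j≥1 ¬grows with nonNeg? ((defect j ⊕ defect z) ⊖ fromℕ 1)
  ... | yes sum≥1 = trans (defect-≡ (⌈ j ξ⌉ + ⌈ z ξ⌉ - + 1) (j ℕ.+ z) sum-1∈) (gap-sum-1 j z)
    where
    sum-1∈ : UnitInterval (gap (⌈ j ξ⌉ + ⌈ z ξ⌉ - + 1) (j ℕ.+ z))
    sum-1∈ = subst UnitInterval (sym (gap-sum-1 j z))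
               (sum≥1 , pos-≡ (⊕-pos (proj₂ (defect∈ j)) (proj₂ (defect∈ z))) (two-minus (defect j) (defect z)))
      where
      two-minus : ∀ u v → (fromℕ 1 ⊖ u) ⊕ (fromℕ 1 ⊖ v) ≡ fromℕ 1 ⊖ ((u ⊕ v) ⊖ fromℕ 1)
      two-minus (a , b) (c , d) = cong₂ _,_ (first a c) (second b d)
        where
        first : ∀ a c → + 1 + - a + (+ 1 + - c) ≡ + 1 + - (a + c + - + 1)
        first = solve-∀
        second : ∀ b d → 0ℤ + - b + (0ℤ + - d) ≡ 0ℤ + - (b + d + - 0ℤ)
        second = solve-∀
  ... | no sum≱1 = contradiction grows ¬grows
    where
    sum<1 : IsPositive (fromℕ 1 ⊖ (defect j ⊕ defect z))
    sum<1 = pos-≡ (¬nonNeg⇒neg sum≱1) (⊝-⊖ (defect j ⊕ defect z) (fromℕ 1))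
    sum∈ : UnitInterval (gap (⌈ j ξ⌉ + ⌈ z ξ⌉) (j ℕ.+ z))
    sum∈ = subst UnitInterval (sym (gap-+ ⌈ j ξ⌉ ⌈ z ξ⌉ j z)) (⊕-nonNeg (proj₁ (defect∈ j)) (proj₁ (defect∈ z)) , sum<1)
    grows : IsPositive (defect (j ℕ.+ z) ⊖ defect z)
    grows = pos-≡ (gap-pos ⌈ j ξ⌉ j j≥1 (defect∈ j)) (begin
      defect j                              ≡⟨ sym (add-sub (defect j) (defect z)) ⟩
      (defect j ⊕ defect z) ⊖ defect z
        ≡⟨ cong (_⊖ defect z) (sym (trans (defect-≡ (⌈ j ξ⌉ + ⌈ z ξ⌉) (j ℕ.+ z) sum∈) (gap-+ ⌈ j ξ⌉ ⌈ z ξ⌉ j z))) ⟩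
      defect (j ℕ.+ z) ⊖ defect z           ∎)
      where
      open ≡-Reasoning
      add-sub : ∀ u v → (u ⊕ v) ⊖ v ≡ u
      add-sub (a , b) (c , d) = cong₂ _,_ (cancel a c) (cancel b d)
        where
        cancel : ∀ a c → a + c + - c ≡ a
        cancel = solve-∀


  walk : ∀ z → (i : ℕ) → (Σ ℕ λ y → 1 ℕ.≤ y × IsPositive (defect y ⊖ defect z))
                          ⊎ defect (1 ℕ.+ i ℕ.* z) ≡ defect 1 ⊖ (+ i) ⊙ (fromℕ 1 ⊖ defect z)
  walk z zero = inj₂ (sym (⊕-identityʳ (defect 1)))
  walk z (suc i) with walk z i
  ... | inj₁ exceeds = inj₁ exceeds
  ... | inj₂ defect≡ with pos? (defect (1 ℕ.+ i ℕ.* z ℕ.+ z) ⊖ defect z)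
  ...   | yes grows  = inj₁ (1 ℕ.+ i ℕ.* z ℕ.+ z , s≤s z≤n , grows)
  ...   | no  ¬grows = inj₂ (begin
    defect (1 ℕ.+ suc i ℕ.* z)                                        ≡⟨ cong (λ n → defect (suc n)) (ℕP.+-comm z (i ℕ.* z)) ⟩
    defect (1 ℕ.+ i ℕ.* z ℕ.+ z)                                      ≡⟨ defect-step (1 ℕ.+ i ℕ.* z) z (s≤s z≤n) ¬grows ⟩
    (defect (1 ℕ.+ i ℕ.* z) ⊕ defect z) ⊖ fromℕ 1                     ≡⟨ cong (λ v → (v ⊕ defect z) ⊖ fromℕ 1) defect≡ ⟩
    ((defect 1 ⊖ (+ i) ⊙ (fromℕ 1 ⊖ defect z)) ⊕ defect z) ⊖ fromℕ 1 ≡⟨ one-more-step (defect 1) (defect z) (+ i) ⟩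
    defect 1 ⊖ (+ suc i) ⊙ (fromℕ 1 ⊖ defect z)                       ∎)
    where
    open ≡-Reasoning
    one-more-step : ∀ u w i → ((u ⊖ i ⊙ (fromℕ 1 ⊖ w)) ⊕ w) ⊖ fromℕ 1 ≡ u ⊖ (+ 1 + i) ⊙ (fromℕ 1 ⊖ w)
    one-more-step (a , b) (c , d) i = cong₂ _,_ (first a c i) (second b d i)
      where
      first : ∀ a c i → a + - (i * (+ 1 + - c)) + c + - + 1 ≡ a + - ((+ 1 + i) * (+ 1 + - c))
      first = solve-∀
      second : ∀ b d i → b + - (i * (0ℤ + - d)) + d + - 0ℤ ≡ b + - ((+ 1 + i) * (0ℤ + - d))
      second = solve-∀

  -- Otherwise the defect would become negative along the walk, by the archimedean property.
  defect-exceeds : ∀ z → 1 ℕ.≤ z → Σ ℕ λ y → 1 ℕ.≤ y × IsPositive (defect y ⊖ defect z)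
  defect-exceeds z z≥1 = exceeds (archimedean (proj₂ (defect∈ z)) 0≤surd-part)
    where
    0≤surd-part : 0ℤ ≤ proj₂ (fromℕ 1 ⊖ defect z)
    0≤surd-part = 0≤-≡ (+-nonNeg z) (sym (trans (cong (λ b → 0ℤ + - b) (cong proj₂ (gap≡ ⌈ z ξ⌉ z)))
                                                 (trans (+-identityˡ (- - + z)) (neg-involutive (+ z)))))
    cancel : ∀ u v → (u ⊖ v) ⊕ ((fromℕ 1 ⊖ u) ⊕ (v ⊖ fromℕ 1)) ≡ fromℕ 0
    cancel (a , b) (c , d) = cong₂ _,_ (first a c) (second b d)
      where
      first : ∀ a c → a + - c + (+ 1 + - a + (c + - + 1)) ≡ 0ℤ
      first = solve-∀
      second : ∀ b d → b + - d + (0ℤ + - b + (d + - 0ℤ)) ≡ 0ℤ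
      second = solve-∀
    exceeds : (Σ ℕ λ n → IsPositive ((+ n) ⊙ (fromℕ 1 ⊖ defect z) ⊖ fromℕ 1)) →
              Σ ℕ λ y → 1 ℕ.≤ y × IsPositive (defect y ⊖ defect z)
    exceeds (n , n[1-defect]>1) = [ id , impossible ]′ (walk z n)
      where
      v : OK
      v = (+ n) ⊙ (fromℕ 1 ⊖ defect z)
      impossible : defect (1 ℕ.+ n ℕ.* z) ≡ defect 1 ⊖ v → Σ ℕ λ y → 1 ℕ.≤ y × IsPositive (defect y ⊖ defect z)
      impossible defect≡ = ⊥-elim (¬pos-0 (pos-≡ sum>0 sum≡0))
        where
        sum>0 : IsPositive (defect (1 ℕ.+ n ℕ.* z) ⊕ ((fromℕ 1 ⊖ defect 1) ⊕ (v ⊖ fromℕ 1)))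
        sum>0 = ⊕-nonNeg-pos (proj₁ (defect∈ (1 ℕ.+ n ℕ.* z))) (⊕-pos (proj₂ (defect∈ 1)) n[1-defect]>1)
        sum≡0 : defect (1 ℕ.+ n ℕ.* z) ⊕ ((fromℕ 1 ⊖ defect 1) ⊕ (v ⊖ fromℕ 1)) ≡ fromℕ 0
        sum≡0 = trans (cong (λ u → u ⊕ ((fromℕ 1 ⊖ defect 1) ⊕ (v ⊖ fromℕ 1))) defect≡) (cancel (defect 1) v)

  Maximises : ℕ → ℕ → Set
  Maximises n z = 1 ℕ.≤ z × z ℕ.≤ n × (∀ j → 1 ℕ.≤ j → j ℕ.≤ n → IsNonNegative (defect z ⊖ defect j))

  private
    extend-max : ∀ {n} → Σ ℕ (Maximises (suc n)) → Σ ℕ (Maximises (suc (suc n)))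
    extend-max {n} (z , z≥1 , z≤ , max) = choose (pos? (defect (suc (suc n)) ⊖ defect z))
      where
      choose : Dec (IsPositive (defect (suc (suc n)) ⊖ defect z)) → Σ ℕ (Maximises (suc (suc n)))
      choose (yes new>z) = suc (suc n) , s≤s z≤n , ℕP.≤-refl , new-max
        where
        new-max : ∀ j → 1 ℕ.≤ j → j ℕ.≤ suc (suc n) → IsNonNegative (defect (suc (suc n)) ⊖ defect j)
        new-max j j≥1 j≤ with ℕP.m≤n⇒m<n∨m≡n j≤
        ... | inj₁ (s≤s j≤n+1) =
          inj₁ (pos-≡ (⊕-pos-nonNeg new>z (max j j≥1 j≤n+1)) (⊖-trans (defect (suc (suc n))) (defect z) (defect j)))
        ... | inj₂ refl        = inj₂ (⊖-self (defect j))
      choose (no new≯z) = z , z≥1 , ℕP.m≤n⇒m≤1+n z≤ , old-max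
        where
        old-max : ∀ j → 1 ℕ.≤ j → j ℕ.≤ suc (suc n) → IsNonNegative (defect z ⊖ defect j)
        old-max j j≥1 j≤ with ℕP.m≤n⇒m<n∨m≡n j≤
        ... | inj₁ (s≤s j≤n+1) = max j j≥1 j≤n+1
        ... | inj₂ refl        = subst IsNonNegative (⊝-⊖ (defect j) (defect z)) (¬pos⇒nonNeg-neg new≯z)

  argmax : ∀ n → 1 ℕ.≤ n → Σ ℕ (Maximises n)
  argmax (suc zero) _ = 1 , s≤s z≤n , s≤s z≤n , only-1
    where
    only-1 : ∀ j → 1 ℕ.≤ j → j ℕ.≤ 1 → IsNonNegative (defect 1 ⊖ defect j)
    only-1 (suc zero)    _ _         = inj₂ (⊖-self (defect 1))
    only-1 (suc (suc j)) _ (s≤s ())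
  argmax (suc (suc n)) _ = extend-max (argmax (suc n) (s≤s z≤n))

  defect-record : ∀ N → Σ ℕ λ y → N ℕ.< y × (∀ j → 1 ℕ.≤ j → j ℕ.≤ N → IsPositive (defect y ⊖ defect j))
  defect-record zero = 1 , s≤s z≤n , λ { (suc j) _ () }
  defect-record (suc N) = beyond (argmax (suc N) (s≤s z≤n))
    where
    beyond : Σ ℕ (Maximises (suc N)) → Σ ℕ λ y → suc N ℕ.< y × (∀ j → 1 ℕ.≤ j → j ℕ.≤ suc N → IsPositive (defect y ⊖ defect j))
    beyond (z , z≥1 , _ , max) = record-holder (defect-exceeds z z≥1)
      where
      record-holder : (Σ ℕ λ y → 1 ℕ.≤ y × IsPositive (defect y ⊖ defect z)) →
                      Σ ℕ λ y → suc N ℕ.< y × (∀ j → 1 ℕ.≤ j → j ℕ.≤ suc N → IsPositive (defect y ⊖ defect j))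
      record-holder (y , y≥1 , y>z) = y , ℕP.≰⇒> y≰N , λ j j≥1 j≤N →
        pos-≡ (⊕-pos-nonNeg y>z (max j j≥1 j≤N)) (⊖-trans (defect y) (defect z) (defect j))
        where
        y≰N : ¬ y ℕ.≤ suc N
        y≰N y≤N = nonNeg⇒¬neg (max y y≥1 y≤N) (pos-≡ y>z (sym (⊝-⊖ (defect z) (defect y))))

  totPos-mkα : ∀ c y → 1 ℕ.≤ y → UnitInterval (gap c y) → TotPos D (mkα c 0 y)
  totPos-mkα c y y≥1 gap∈ =
    conj-pos⇒totPos (mkα c 0 y) (+-nonNeg y) (pos-≡ (gap-pos c y y≥1 gap∈) (sym (trans (conj-mkα c 0 y) (⊕-identityʳ (gap c y)))))

  totPos-mkα-⊖ : ∀ c y c′ y′ → y′ ℕ.≤ y → IsPositive (gap c y ⊖ gap c′ y′) → TotPos D (mkα c 0 y ⊖ mkα c′ 0 y′)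
  totPos-mkα-⊖ c y c′ y′ y′≤y diff>0 = conj-pos⇒totPos (mkα c 0 y ⊖ mkα c′ 0 y′) (i≤j⇒0≤j-i (+≤+ y′≤y))
    (pos-≡ diff>0 (sym (trans (conj-mkα-⊖ c′ 0 y′ c 0 y) (cong₂ _⊖_ (⊕-identityʳ (gap c y)) (⊕-identityʳ (gap c′ y′))))))

  -- α and β_j + (α − β_j) with β_j = ⌈ j ξ ⌉ + j ω, 1 ≤ j ≤ m: α − β_j is totally positive as the
  -- defect of y exceeds that of j, and the splittings differ as y > 2m.
  partitions : ∀ m y → m ℕ.+ m ℕ.< y → (∀ j → 1 ℕ.≤ j → j ℕ.≤ m ℕ.+ m → IsPositive (defect y ⊖ defect j)) →
               (c : ℤ) → IsCeil D c (mul D (fromℕ y) (ξ D)) → PAtLeast D (mkα c 0 y) (suc m)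
  partitions m y 2m<y y-record c ceil = parts , is-partition , distinct
    where
    index : Fin m → ℕ
    index i = suc (toℕ i)
    index≤m : ∀ i → index i ℕ.≤ m
    index≤m = toℕ<n
    β : Fin m → OK
    β i = mkα ⌈ index i ξ⌉ 0 (index i)
    α : OK
    α = mkα c 0 y
    gap∈ : UnitInterval (gap c y)
    gap∈ = isCeil⇒unitInterval c y ceil
    parts : Fin (suc m) → List OK
    parts Fin.zero    = α ∷ []
    parts (Fin.suc i) = β i ∷ α ⊖ β i ∷ []
    is-partition : ∀ i → IsPartition D α (parts i)
    is-partition Fin.zero = (totPos-mkα c y (ℕP.<-≤-trans (s≤s z≤n) 2m<y) gap∈ All.∷ All.[]) , ⊕-identityʳ α
    is-partition (Fin.suc i) = (totPos-mkα ⌈ index i ξ⌉ (index i) (s≤s z≤n) (defect∈ (index i))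
                            All.∷ totPos-mkα-⊖ c y ⌈ index i ξ⌉ (index i) index≤y
                                (pos-≡ (y-record (index i) (s≤s z≤n) (ℕP.≤-trans (index≤m i) (ℕP.m≤m+n m m)))
                                       (cong (_⊖ defect (index i)) (defect-≡ c y gap∈)))
                            All.∷ All.[]) , split (β i) α
      where
      index≤y : index i ℕ.≤ y
      index≤y = ℕP.≤-trans (index≤m i) (ℕP.≤-trans (ℕP.m≤m+n m m) (ℕP.<⇒≤ 2m<y))
      split : ∀ u v → u ⊕ ((v ⊖ u) ⊕ fromℕ 0) ≡ v
      split (a , b) (c , d) = cong₂ _,_ (cancel a c) (cancel b d)
        where
        cancel : ∀ a c → a + (c + - a + 0ℤ) ≡ c
        cancel = solve-∀
    different-lengths : ∀ {u v w : OK} → ¬ (u ∷ [] ↭ v ∷ w ∷ [])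
    different-lengths p with ↭-length p
    ... | ()
    distinct : ∀ i j → i ≢ j → ¬ (parts i ↭ parts j)
    distinct Fin.zero    Fin.zero    i≢j _ = i≢j refl
    distinct Fin.zero    (Fin.suc j) _   p = different-lengths p
    distinct (Fin.suc i) Fin.zero    _   p = different-lengths (↭-sym p)
    distinct (Fin.suc i) (Fin.suc j) i≢j p = βi∉ (∈-resp-↭ p (here refl))
      where
      βi∉ : ¬ (β i ∈ parts (Fin.suc j))
      βi∉ (here βi≡βj) = i≢j (cong Fin.suc (toℕ-injective (ℕP.suc-injective (+-injective (cong proj₂ βi≡βj)))))
      βi∉ (there (here βi≡α-βj)) =
        ℕP.<-irrefl refl (ℕP.<-≤-trans 2m<y (ℕP.≤-trans (ℕP.≤-reflexive y≡) (ℕP.+-mono-≤ (index≤m i) (index≤m j))))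
        where
        cancel : ∀ y j → y + - j + j ≡ y
        cancel = solve-∀
        y≡ : y ≡ index i ℕ.+ index j
        y≡ = +-injective (trans (sym (cancel (+ y) (+ index j))) (cong (_+ + index j) (sym (cong proj₂ βi≡α-βj))))
      βi∉ (there (there ()))

  lemma5p3-i : (m : ℕ) → 1 ℕ.≤ m → Σ ℕ λ y → (c : ℤ) → IsCeil D c (mul D (fromℕ y) (ξ D)) → PAtLeast D (mkα c 0 y) m
  lemma5p3-i (suc m) _ with defect-record (m ℕ.+ m)
  ... | y , 2m<y , y-record = y , partitions m y 2m<y y-record

open import Data.Nat using (_≤_; _<_)

lemma5p3 : (D : ℕ) → 2 ≤ D → SquareFree D →
    ((m : ℕ) → 1 ≤ m → Σ ℕ λ y → (c : ℤ) → IsCeil D c (mul D (fromℕ y) (ξ D)) →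
        PAtLeast D (mkα c 0 y) m)
  × ((ε : OK) → IsEpsPlus D ε → (y k : ℕ) (c : ℤ) → IsCeil D c (mul D (fromℕ y) (ξ D)) →
        mkα c k y ≢ fromℕ 0 →
        QuotLe D (mkα c k y) (conj D (mkα c k y)) ε →
        mul D (fromℕ y) (ξ D ⊕ ω D) <[ D ] (mul D (fromℕ (suc k)) ε ⊖ fromℕ k))
  × ((k₁ y₁ k₂ y₂ : ℕ) (c₁ c₂ : ℤ) →
        IsCeil D c₁ (mul D (fromℕ y₁) (ξ D)) → IsCeil D c₂ (mul D (fromℕ y₂) (ξ D)) →
        y₁ ≤ y₂ → k₁ < k₂ → mkα c₁ k₁ y₁ ≺[ D ] mkα c₂ k₂ y₂)
  × ((k₁ y₁ k₂ y₂ : ℕ) (c₁ c₂ : ℤ) →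
        IsCeil D c₁ (mul D (fromℕ y₁) (ξ D)) → IsCeil D c₂ (mul D (fromℕ y₂) (ξ D)) →
        mkα c₁ k₁ y₁ ⪯[ D ] mkα c₂ k₂ y₂ → k₁ ≤ k₂)
lemma5p3 D D≥2 squareFree =
  -- α ≠ 0 is only needed for α / α′ to make sense.
  lemma5p3-i , (λ ε ε₊ y k c ceil _ → lemma5p3-ii ε ε₊ y k c ceil) , lemma5p3-iii , lemma5p3-iv
  where
  irrational : IrrationalSqrt (+ D)
  irrational = SquareFreeIrrational.squareFree⇒irrational D≥2 squareFree
  open Ceilings D irrational
  open Density D irrational
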